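{- Up to isomorphism, the 1-generated exact Kleene algebras are exactly the free 1-generated Kleene algebra $\mathbf F_{\mathsf{KA}}(z)$, the four-element Kleene chain $\mathbf K_4$, and the two-element Boolean algebra $\mathbf 2_{\mathsf{KA}}$; moreover, all three are projective in $\mathsf{KA}$.
   Context: A Kleene algebra is an algebra $(A,\wedge,\vee,\neg,0,1)$ that is a bounded distributive lattice with $\neg\neg x\approx x$, $x\wedge y\approx\neg(\neg x\vee\neg y)$ and $x\wedge\neg x\le y\vee\neg y$; $\mathsf{KA}$ is the variety of Kleene algebras. $\mathbf F_{\mathsf{KA}}(z)$ is the 6-element algebra with elements $0<z\wedge\neg z<z,\neg z<z\vee\neg z<1$ ($z,\neg z$ incomparable). $\mathbf K_4$ is the chain $0<b<a<1$ with $\neg 0=1$, $\neg a=b$; $\mathbf 2_{\mathsf{KA}}$ is $\{0,1\}$ with $\neg0=1$. An algebra is exact in $\mathsf{KA}$ if it is isomorphic to a finitely generated subalgebra of a finitely generated free Kleene algebra; projective if it is a retract of a free Kleene algebra. -}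

module Defs where

open import Level using (Level; _⊔_; suc; 0ℓ)
open import Algebra.Core using (Op₁; Op₂)
open import Algebra.Definitions using (Identity; Involutive)
open import Algebra.Lattice.Structures using (IsDistributiveLattice; IsLattice)
open import Relation.Binary.Core using (Rel)
open import Relation.Binary.Structures using (IsEquivalence)
open import Relation.Binary.PropositionalEquality as P using (_≡_; refl)
open import Data.Product using (Σ; Σ-syntax; _×_; _,_)
open import Data.Sum using (_⊎_)
open import Data.Nat using (ℕ)
open import Data.Fin using (Fin)

-- (A, ∧, ∨, ¬, 0, 1) a bounded distributive lattice with
--   ¬¬x ≈ x,  x ∧ y ≈ ¬(¬x ∨ ¬y),  x ∧ ¬x ≤ y ∨ ¬y
-- where a ≤ b  means  a ∧ b ≈ a.
record IsKleeneAlgebra {a ℓ} {A : Set a} (_≈_ : Rel A ℓ)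
         (_∧_ _∨_ : Op₂ A) (¬_ : Op₁ A) (⊥ ⊤ : A) : Set (a ⊔ ℓ) where
  field
    isDistributiveLattice : IsDistributiveLattice _≈_ _∨_ _∧_
    ¬-cong     : ∀ {x y} → x ≈ y → (¬ x) ≈ (¬ y)
    ∨-identity : Identity _≈_ ⊥ _∨_
    ∧-identity : Identity _≈_ ⊤ _∧_
    ¬-involutive : Involutive _≈_ ¬_
    deMorgan   : ∀ x y → (x ∧ y) ≈ (¬ ((¬ x) ∨ (¬ y)))
    kleene     : ∀ x y → ((x ∧ (¬ x)) ∧ (y ∨ (¬ y))) ≈ (x ∧ (¬ x))

record KleeneAlgebra c ℓ : Set (suc (c ⊔ ℓ)) where
  infix  4 _≈_
  infixr 7 _∧_
  infixr 6 _∨_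
  field
    Carrier : Set c
    _≈_     : Rel Carrier ℓ
    _∧_     : Op₂ Carrier
    _∨_     : Op₂ Carrier
    ¬_      : Op₁ Carrier
    0#      : Carrier
    1#      : Carrier
    isKleeneAlgebra : IsKleeneAlgebra _≈_ _∧_ _∨_ ¬_ 0# 1#

  open IsKleeneAlgebra isKleeneAlgebra public

  _≤_ : Rel Carrier ℓ
  x ≤ y = (x ∧ y) ≈ x

module _ {c₁ ℓ₁ c₂ ℓ₂} (A : KleeneAlgebra c₁ ℓ₁) (B : KleeneAlgebra c₂ ℓ₂) where
  private
    module A = KleeneAlgebra A
    module B = KleeneAlgebra B

  record Hom : Set (c₁ ⊔ ℓ₁ ⊔ c₂ ⊔ ℓ₂) where
    field
      ⟦_⟧    : A.Carrier → B.Carrier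
      cong   : ∀ {x y} → x A.≈ y → ⟦ x ⟧ B.≈ ⟦ y ⟧
      hom-∧  : ∀ x y → ⟦ x A.∧ y ⟧ B.≈ (⟦ x ⟧ B.∧ ⟦ y ⟧)
      hom-∨  : ∀ x y → ⟦ x A.∨ y ⟧ B.≈ (⟦ x ⟧ B.∨ ⟦ y ⟧)
      hom-¬  : ∀ x → ⟦ A.¬ x ⟧ B.≈ (B.¬ ⟦ x ⟧)
      hom-0  : ⟦ A.0# ⟧ B.≈ B.0#
      hom-1  : ⟦ A.1# ⟧ B.≈ B.1#

  Embedding : Set (c₁ ⊔ ℓ₁ ⊔ c₂ ⊔ ℓ₂)
  Embedding = Σ[ h ∈ Hom ] (∀ x y → Hom.⟦ h ⟧ x B.≈ Hom.⟦ h ⟧ y → x A.≈ y)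

module _ {c₁ ℓ₁ c₂ ℓ₂} (A : KleeneAlgebra c₁ ℓ₁) (B : KleeneAlgebra c₂ ℓ₂) where
  private
    module A = KleeneAlgebra A
    module B = KleeneAlgebra B

  Retract : Set (c₁ ⊔ ℓ₁ ⊔ c₂ ⊔ ℓ₂)
  Retract = Σ[ s ∈ Hom A B ] Σ[ r ∈ Hom B A ]
              (∀ x → Hom.⟦ r ⟧ (Hom.⟦ s ⟧ x) A.≈ x)

  _≅_ : Set (c₁ ⊔ ℓ₁ ⊔ c₂ ⊔ ℓ₂)
  _≅_ = Σ[ f ∈ Hom A B ] Σ[ g ∈ Hom B A ]
          ((∀ x → Hom.⟦ g ⟧ (Hom.⟦ f ⟧ x) A.≈ x) ×
           (∀ y → Hom.⟦ f ⟧ (Hom.⟦ g ⟧ y) B.≈ y))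

data Term {a} (X : Set a) : Set a where
  var   : X → Term X
  _∧'_  : Term X → Term X → Term X
  _∨'_  : Term X → Term X → Term X
  ¬'_   : Term X → Term X
  0'    : Term X
  1'    : Term X

module _ {c ℓ} (A : KleeneAlgebra c ℓ) where
  open KleeneAlgebra A

  eval : ∀ {a} {X : Set a} → (X → Carrier) → Term X → Carrier
  eval v (var x)   = v x
  eval v (t ∧' u)  = eval v t ∧ eval v u
  eval v (t ∨' u)  = eval v t ∨ eval v u
  eval v (¬' t)    = ¬ eval v t
  eval v 0'        = 0#
  eval v 1'        = 1#

  GeneratedBy : ∀ {k} → (Fin k → Carrier) → Set (c ⊔ ℓ)
  GeneratedBy {k} g = ∀ x → Σ[ t ∈ Term (Fin k) ] eval g t ≈ x

  FinitelyGenerated : Set (c ⊔ ℓ)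
  FinitelyGenerated = Σ[ k ∈ ℕ ] Σ[ g ∈ (Fin k → Carrier) ] GeneratedBy g

  OneGenerated : Set (c ⊔ ℓ)
  OneGenerated = Σ[ a ∈ Carrier ] GeneratedBy {1} (λ _ → a)

module _ {a} {X : Set a} where
  infix 4 _~_
  data _~_ : Term X → Term X → Set a where
    ~refl  : ∀ {t} → t ~ t
    ~sym   : ∀ {t u} → t ~ u → u ~ t
    ~trans : ∀ {t u v} → t ~ u → u ~ v → t ~ v
    ∧-cg   : ∀ {t t' u u'} → t ~ t' → u ~ u' → (t ∧' u) ~ (t' ∧' u')
    ∨-cg   : ∀ {t t' u u'} → t ~ t' → u ~ u' → (t ∨' u) ~ (t' ∨' u')
    ¬-cg   : ∀ {t t'} → t ~ t' → (¬' t) ~ (¬' t')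
    ∨-comm-ax  : ∀ x y → (x ∨' y) ~ (y ∨' x)
    ∧-comm-ax  : ∀ x y → (x ∧' y) ~ (y ∧' x)
    ∨-assoc-ax : ∀ x y z → ((x ∨' y) ∨' z) ~ (x ∨' (y ∨' z))
    ∧-assoc-ax : ∀ x y z → ((x ∧' y) ∧' z) ~ (x ∧' (y ∧' z))
    ∨-abs-ax   : ∀ x y → (x ∨' (x ∧' y)) ~ x
    ∧-abs-ax   : ∀ x y → (x ∧' (x ∨' y)) ~ x
    ∧-distˡ-ax : ∀ x y z → (x ∧' (y ∨' z)) ~ ((x ∧' y) ∨' (x ∧' z))
    ∨-distˡ-ax : ∀ x y z → (x ∨' (y ∧' z)) ~ ((x ∨' y) ∧' (x ∨' z))
    ∨-id-ax    : ∀ x → (x ∨' 0') ~ x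
    ∧-id-ax    : ∀ x → (x ∧' 1') ~ x
    ¬¬-ax      : ∀ x → (¬' (¬' x)) ~ x
    deMorgan-ax : ∀ x y → (x ∧' y) ~ (¬' ((¬' x) ∨' (¬' y)))
    kleene-ax  : ∀ x y → ((x ∧' (¬' x)) ∧' (y ∨' (¬' y))) ~ (x ∧' (¬' x))

  freeIsKA : IsKleeneAlgebra _~_ _∧'_ _∨'_ ¬'_ 0' 1'
  freeIsKA = record
    { isDistributiveLattice = record
      { isLattice = record
        { isEquivalence = record { refl = ~refl ; sym = ~sym ; trans = ~trans }
        ; ∨-comm = ∨-comm-ax
        ; ∨-assoc = ∨-assoc-ax
        ; ∨-cong = ∨-cg
        ; ∧-comm = ∧-comm-ax
        ; ∧-assoc = ∧-assoc-ax
        ; ∧-cong = ∧-cg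
        ; absorptive = ∨-abs-ax , ∧-abs-ax
        }
      ; ∨-distrib-∧ = ∨-distˡ-ax , λ x y z →
          ~trans (∨-comm-ax (y ∧' z) x)
            (~trans (∨-distˡ-ax x y z) (∧-cg (∨-comm-ax x y) (∨-comm-ax x z)))
      ; ∧-distrib-∨ = ∧-distˡ-ax , λ x y z →
          ~trans (∧-comm-ax (y ∨' z) x)
            (~trans (∧-distˡ-ax x y z) (∨-cg (∧-comm-ax x y) (∧-comm-ax x z)))
      }
    ; ¬-cong = ¬-cg
    ; ∨-identity = (λ x → ~trans (∨-comm-ax 0' x) (∨-id-ax x)) , ∨-id-ax
    ; ∧-identity = (λ x → ~trans (∧-comm-ax 1' x) (∧-id-ax x)) , ∧-id-ax
    ; ¬-involutive = ¬¬-ax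
    ; deMorgan = deMorgan-ax
    ; kleene = kleene-ax
    }

Free : ∀ {a} (X : Set a) → KleeneAlgebra a a
Free X = record
  { Carrier = Term X ; _≈_ = _~_ ; _∧_ = _∧'_ ; _∨_ = _∨'_ ; ¬_ = ¬'_
  ; 0# = 0' ; 1# = 1' ; isKleeneAlgebra = freeIsKA }

F₁ : KleeneAlgebra 0ℓ 0ℓ
F₁ = Free (Fin 1)

Exact : ∀ {c ℓ} → KleeneAlgebra c ℓ → Set (c ⊔ ℓ)
Exact A = FinitelyGenerated A × Σ[ n ∈ ℕ ] Embedding A (Free (Fin n))

Projective : ∀ {c ℓ} → KleeneAlgebra c ℓ → Set (suc c ⊔ ℓ)
Projective {c} A = Σ[ X ∈ Set c ] Retract A (Free X)

-- K₄ : the chain 0 < b < a < 1 with ¬0 = 1, ¬a = b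
data K₄-El : Set where
  k0 kb ka k1 : K₄-El

K₄-∧ : K₄-El → K₄-El → K₄-El
K₄-∧ k0 k0 = k0
K₄-∧ k0 kb = k0
K₄-∧ k0 ka = k0
K₄-∧ k0 k1 = k0
K₄-∧ kb k0 = k0
K₄-∧ kb kb = kb
K₄-∧ kb ka = kb
K₄-∧ kb k1 = kb
K₄-∧ ka k0 = k0
K₄-∧ ka kb = kb
K₄-∧ ka ka = ka
K₄-∧ ka k1 = ka
K₄-∧ k1 k0 = k0
K₄-∧ k1 kb = kb
K₄-∧ k1 ka = ka
K₄-∧ k1 k1 = k1
K₄-∨ : K₄-El → K₄-El → K₄-El
K₄-∨ k0 k0 = k0
K₄-∨ k0 kb = kb
K₄-∨ k0 ka = ka
K₄-∨ k0 k1 = k1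
K₄-∨ kb k0 = kb
K₄-∨ kb kb = kb
K₄-∨ kb ka = ka
K₄-∨ kb k1 = k1
K₄-∨ ka k0 = ka
K₄-∨ ka kb = ka
K₄-∨ ka ka = ka
K₄-∨ ka k1 = k1
K₄-∨ k1 k0 = k1
K₄-∨ k1 kb = k1
K₄-∨ k1 ka = k1
K₄-∨ k1 k1 = k1
K₄-¬ : K₄-El → K₄-El
K₄-¬ k0 = k1
K₄-¬ kb = ka
K₄-¬ ka = kb
K₄-¬ k1 = k0

K₄-∨-comm : (x y : K₄-El) → K₄-∨ x y ≡ K₄-∨ y x
K₄-∨-comm k0 k0 = refl
K₄-∨-comm k0 kb = refl
K₄-∨-comm k0 ka = refl
K₄-∨-comm k0 k1 = refl
K₄-∨-comm kb k0 = refl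
K₄-∨-comm kb kb = refl
K₄-∨-comm kb ka = refl
K₄-∨-comm kb k1 = refl
K₄-∨-comm ka k0 = refl
K₄-∨-comm ka kb = refl
K₄-∨-comm ka ka = refl
K₄-∨-comm ka k1 = refl
K₄-∨-comm k1 k0 = refl
K₄-∨-comm k1 kb = refl
K₄-∨-comm k1 ka = refl
K₄-∨-comm k1 k1 = refl
K₄-∧-comm : (x y : K₄-El) → K₄-∧ x y ≡ K₄-∧ y x
K₄-∧-comm k0 k0 = refl
K₄-∧-comm k0 kb = refl
K₄-∧-comm k0 ka = refl
K₄-∧-comm k0 k1 = refl
K₄-∧-comm kb k0 = refl
K₄-∧-comm kb kb = refl
K₄-∧-comm kb ka = refl
K₄-∧-comm kb k1 = refl
K₄-∧-comm ka k0 = refl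
K₄-∧-comm ka kb = refl
K₄-∧-comm ka ka = refl
K₄-∧-comm ka k1 = refl
K₄-∧-comm k1 k0 = refl
K₄-∧-comm k1 kb = refl
K₄-∧-comm k1 ka = refl
K₄-∧-comm k1 k1 = refl
K₄-∨-assoc : (x y z : K₄-El) → K₄-∨ (K₄-∨ x y) z ≡ K₄-∨ x (K₄-∨ y z)
K₄-∨-assoc k0 k0 k0 = refl
K₄-∨-assoc k0 k0 kb = refl
K₄-∨-assoc k0 k0 ka = refl
K₄-∨-assoc k0 k0 k1 = refl
K₄-∨-assoc k0 kb k0 = refl
K₄-∨-assoc k0 kb kb = refl
K₄-∨-assoc k0 kb ka = refl
K₄-∨-assoc k0 kb k1 = refl
K₄-∨-assoc k0 ka k0 = refl
K₄-∨-assoc k0 ka kb = refl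
K₄-∨-assoc k0 ka ka = refl
K₄-∨-assoc k0 ka k1 = refl
K₄-∨-assoc k0 k1 k0 = refl
K₄-∨-assoc k0 k1 kb = refl
K₄-∨-assoc k0 k1 ka = refl
K₄-∨-assoc k0 k1 k1 = refl
K₄-∨-assoc kb k0 k0 = refl
K₄-∨-assoc kb k0 kb = refl
K₄-∨-assoc kb k0 ka = refl
K₄-∨-assoc kb k0 k1 = refl
K₄-∨-assoc kb kb k0 = refl
K₄-∨-assoc kb kb kb = refl
K₄-∨-assoc kb kb ka = refl
K₄-∨-assoc kb kb k1 = refl
K₄-∨-assoc kb ka k0 = refl
K₄-∨-assoc kb ka kb = refl
K₄-∨-assoc kb ka ka = refl
K₄-∨-assoc kb ka k1 = refl
K₄-∨-assoc kb k1 k0 = refl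
K₄-∨-assoc kb k1 kb = refl
K₄-∨-assoc kb k1 ka = refl
K₄-∨-assoc kb k1 k1 = refl
K₄-∨-assoc ka k0 k0 = refl
K₄-∨-assoc ka k0 kb = refl
K₄-∨-assoc ka k0 ka = refl
K₄-∨-assoc ka k0 k1 = refl
K₄-∨-assoc ka kb k0 = refl
K₄-∨-assoc ka kb kb = refl
K₄-∨-assoc ka kb ka = refl
K₄-∨-assoc ka kb k1 = refl
K₄-∨-assoc ka ka k0 = refl
K₄-∨-assoc ka ka kb = refl
K₄-∨-assoc ka ka ka = refl
K₄-∨-assoc ka ka k1 = refl
K₄-∨-assoc ka k1 k0 = refl
K₄-∨-assoc ka k1 kb = refl
K₄-∨-assoc ka k1 ka = refl
K₄-∨-assoc ka k1 k1 = refl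
K₄-∨-assoc k1 k0 k0 = refl
K₄-∨-assoc k1 k0 kb = refl
K₄-∨-assoc k1 k0 ka = refl
K₄-∨-assoc k1 k0 k1 = refl
K₄-∨-assoc k1 kb k0 = refl
K₄-∨-assoc k1 kb kb = refl
K₄-∨-assoc k1 kb ka = refl
K₄-∨-assoc k1 kb k1 = refl
K₄-∨-assoc k1 ka k0 = refl
K₄-∨-assoc k1 ka kb = refl
K₄-∨-assoc k1 ka ka = refl
K₄-∨-assoc k1 ka k1 = refl
K₄-∨-assoc k1 k1 k0 = refl
K₄-∨-assoc k1 k1 kb = refl
K₄-∨-assoc k1 k1 ka = refl
K₄-∨-assoc k1 k1 k1 = refl
K₄-∧-assoc : (x y z : K₄-El) → K₄-∧ (K₄-∧ x y) z ≡ K₄-∧ x (K₄-∧ y z)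
K₄-∧-assoc k0 k0 k0 = refl
K₄-∧-assoc k0 k0 kb = refl
K₄-∧-assoc k0 k0 ka = refl
K₄-∧-assoc k0 k0 k1 = refl
K₄-∧-assoc k0 kb k0 = refl
K₄-∧-assoc k0 kb kb = refl
K₄-∧-assoc k0 kb ka = refl
K₄-∧-assoc k0 kb k1 = refl
K₄-∧-assoc k0 ka k0 = refl
K₄-∧-assoc k0 ka kb = refl
K₄-∧-assoc k0 ka ka = refl
K₄-∧-assoc k0 ka k1 = refl
K₄-∧-assoc k0 k1 k0 = refl
K₄-∧-assoc k0 k1 kb = refl
K₄-∧-assoc k0 k1 ka = refl
K₄-∧-assoc k0 k1 k1 = refl
K₄-∧-assoc kb k0 k0 = refl
K₄-∧-assoc kb k0 kb = refl
K₄-∧-assoc kb k0 ka = refl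
K₄-∧-assoc kb k0 k1 = refl
K₄-∧-assoc kb kb k0 = refl
K₄-∧-assoc kb kb kb = refl
K₄-∧-assoc kb kb ka = refl
K₄-∧-assoc kb kb k1 = refl
K₄-∧-assoc kb ka k0 = refl
K₄-∧-assoc kb ka kb = refl
K₄-∧-assoc kb ka ka = refl
K₄-∧-assoc kb ka k1 = refl
K₄-∧-assoc kb k1 k0 = refl
K₄-∧-assoc kb k1 kb = refl
K₄-∧-assoc kb k1 ka = refl
K₄-∧-assoc kb k1 k1 = refl
K₄-∧-assoc ka k0 k0 = refl
K₄-∧-assoc ka k0 kb = refl
K₄-∧-assoc ka k0 ka = refl
K₄-∧-assoc ka k0 k1 = refl
K₄-∧-assoc ka kb k0 = refl
K₄-∧-assoc ka kb kb = refl
K₄-∧-assoc ka kb ka = refl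
K₄-∧-assoc ka kb k1 = refl
K₄-∧-assoc ka ka k0 = refl
K₄-∧-assoc ka ka kb = refl
K₄-∧-assoc ka ka ka = refl
K₄-∧-assoc ka ka k1 = refl
K₄-∧-assoc ka k1 k0 = refl
K₄-∧-assoc ka k1 kb = refl
K₄-∧-assoc ka k1 ka = refl
K₄-∧-assoc ka k1 k1 = refl
K₄-∧-assoc k1 k0 k0 = refl
K₄-∧-assoc k1 k0 kb = refl
K₄-∧-assoc k1 k0 ka = refl
K₄-∧-assoc k1 k0 k1 = refl
K₄-∧-assoc k1 kb k0 = refl
K₄-∧-assoc k1 kb kb = refl
K₄-∧-assoc k1 kb ka = refl
K₄-∧-assoc k1 kb k1 = refl
K₄-∧-assoc k1 ka k0 = refl
K₄-∧-assoc k1 ka kb = refl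
K₄-∧-assoc k1 ka ka = refl
K₄-∧-assoc k1 ka k1 = refl
K₄-∧-assoc k1 k1 k0 = refl
K₄-∧-assoc k1 k1 kb = refl
K₄-∧-assoc k1 k1 ka = refl
K₄-∧-assoc k1 k1 k1 = refl
K₄-∨-abs : (x y : K₄-El) → K₄-∨ x (K₄-∧ x y) ≡ x
K₄-∨-abs k0 k0 = refl
K₄-∨-abs k0 kb = refl
K₄-∨-abs k0 ka = refl
K₄-∨-abs k0 k1 = refl
K₄-∨-abs kb k0 = refl
K₄-∨-abs kb kb = refl
K₄-∨-abs kb ka = refl
K₄-∨-abs kb k1 = refl
K₄-∨-abs ka k0 = refl
K₄-∨-abs ka kb = refl
K₄-∨-abs ka ka = refl
K₄-∨-abs ka k1 = refl
K₄-∨-abs k1 k0 = refl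
K₄-∨-abs k1 kb = refl
K₄-∨-abs k1 ka = refl
K₄-∨-abs k1 k1 = refl
K₄-∧-abs : (x y : K₄-El) → K₄-∧ x (K₄-∨ x y) ≡ x
K₄-∧-abs k0 k0 = refl
K₄-∧-abs k0 kb = refl
K₄-∧-abs k0 ka = refl
K₄-∧-abs k0 k1 = refl
K₄-∧-abs kb k0 = refl
K₄-∧-abs kb kb = refl
K₄-∧-abs kb ka = refl
K₄-∧-abs kb k1 = refl
K₄-∧-abs ka k0 = refl
K₄-∧-abs ka kb = refl
K₄-∧-abs ka ka = refl
K₄-∧-abs ka k1 = refl
K₄-∧-abs k1 k0 = refl
K₄-∧-abs k1 kb = refl
K₄-∧-abs k1 ka = refl
K₄-∧-abs k1 k1 = refl
K₄-∨-distˡ : (x y z : K₄-El) → K₄-∨ x (K₄-∧ y z) ≡ K₄-∧ (K₄-∨ x y) (K₄-∨ x z)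
K₄-∨-distˡ k0 k0 k0 = refl
K₄-∨-distˡ k0 k0 kb = refl
K₄-∨-distˡ k0 k0 ka = refl
K₄-∨-distˡ k0 k0 k1 = refl
K₄-∨-distˡ k0 kb k0 = refl
K₄-∨-distˡ k0 kb kb = refl
K₄-∨-distˡ k0 kb ka = refl
K₄-∨-distˡ k0 kb k1 = refl
K₄-∨-distˡ k0 ka k0 = refl
K₄-∨-distˡ k0 ka kb = refl
K₄-∨-distˡ k0 ka ka = refl
K₄-∨-distˡ k0 ka k1 = refl
K₄-∨-distˡ k0 k1 k0 = refl
K₄-∨-distˡ k0 k1 kb = refl
K₄-∨-distˡ k0 k1 ka = refl
K₄-∨-distˡ k0 k1 k1 = refl
K₄-∨-distˡ kb k0 k0 = refl
K₄-∨-distˡ kb k0 kb = refl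
K₄-∨-distˡ kb k0 ka = refl
K₄-∨-distˡ kb k0 k1 = refl
K₄-∨-distˡ kb kb k0 = refl
K₄-∨-distˡ kb kb kb = refl
K₄-∨-distˡ kb kb ka = refl
K₄-∨-distˡ kb kb k1 = refl
K₄-∨-distˡ kb ka k0 = refl
K₄-∨-distˡ kb ka kb = refl
K₄-∨-distˡ kb ka ka = refl
K₄-∨-distˡ kb ka k1 = refl
K₄-∨-distˡ kb k1 k0 = refl
K₄-∨-distˡ kb k1 kb = refl
K₄-∨-distˡ kb k1 ka = refl
K₄-∨-distˡ kb k1 k1 = refl
K₄-∨-distˡ ka k0 k0 = refl
K₄-∨-distˡ ka k0 kb = refl
K₄-∨-distˡ ka k0 ka = refl
K₄-∨-distˡ ka k0 k1 = refl
K₄-∨-distˡ ka kb k0 = refl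
K₄-∨-distˡ ka kb kb = refl
K₄-∨-distˡ ka kb ka = refl
K₄-∨-distˡ ka kb k1 = refl
K₄-∨-distˡ ka ka k0 = refl
K₄-∨-distˡ ka ka kb = refl
K₄-∨-distˡ ka ka ka = refl
K₄-∨-distˡ ka ka k1 = refl
K₄-∨-distˡ ka k1 k0 = refl
K₄-∨-distˡ ka k1 kb = refl
K₄-∨-distˡ ka k1 ka = refl
K₄-∨-distˡ ka k1 k1 = refl
K₄-∨-distˡ k1 k0 k0 = refl
K₄-∨-distˡ k1 k0 kb = refl
K₄-∨-distˡ k1 k0 ka = refl
K₄-∨-distˡ k1 k0 k1 = refl
K₄-∨-distˡ k1 kb k0 = refl
K₄-∨-distˡ k1 kb kb = refl
K₄-∨-distˡ k1 kb ka = refl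
K₄-∨-distˡ k1 kb k1 = refl
K₄-∨-distˡ k1 ka k0 = refl
K₄-∨-distˡ k1 ka kb = refl
K₄-∨-distˡ k1 ka ka = refl
K₄-∨-distˡ k1 ka k1 = refl
K₄-∨-distˡ k1 k1 k0 = refl
K₄-∨-distˡ k1 k1 kb = refl
K₄-∨-distˡ k1 k1 ka = refl
K₄-∨-distˡ k1 k1 k1 = refl
K₄-∨-distʳ : (x y z : K₄-El) → K₄-∨ (K₄-∧ y z) x ≡ K₄-∧ (K₄-∨ y x) (K₄-∨ z x)
K₄-∨-distʳ k0 k0 k0 = refl
K₄-∨-distʳ k0 k0 kb = refl
K₄-∨-distʳ k0 k0 ka = refl
K₄-∨-distʳ k0 k0 k1 = refl
K₄-∨-distʳ k0 kb k0 = refl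
K₄-∨-distʳ k0 kb kb = refl
K₄-∨-distʳ k0 kb ka = refl
K₄-∨-distʳ k0 kb k1 = refl
K₄-∨-distʳ k0 ka k0 = refl
K₄-∨-distʳ k0 ka kb = refl
K₄-∨-distʳ k0 ka ka = refl
K₄-∨-distʳ k0 ka k1 = refl
K₄-∨-distʳ k0 k1 k0 = refl
K₄-∨-distʳ k0 k1 kb = refl
K₄-∨-distʳ k0 k1 ka = refl
K₄-∨-distʳ k0 k1 k1 = refl
K₄-∨-distʳ kb k0 k0 = refl
K₄-∨-distʳ kb k0 kb = refl
K₄-∨-distʳ kb k0 ka = refl
K₄-∨-distʳ kb k0 k1 = refl
K₄-∨-distʳ kb kb k0 = refl
K₄-∨-distʳ kb kb kb = refl
K₄-∨-distʳ kb kb ka = refl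
K₄-∨-distʳ kb kb k1 = refl
K₄-∨-distʳ kb ka k0 = refl
K₄-∨-distʳ kb ka kb = refl
K₄-∨-distʳ kb ka ka = refl
K₄-∨-distʳ kb ka k1 = refl
K₄-∨-distʳ kb k1 k0 = refl
K₄-∨-distʳ kb k1 kb = refl
K₄-∨-distʳ kb k1 ka = refl
K₄-∨-distʳ kb k1 k1 = refl
K₄-∨-distʳ ka k0 k0 = refl
K₄-∨-distʳ ka k0 kb = refl
K₄-∨-distʳ ka k0 ka = refl
K₄-∨-distʳ ka k0 k1 = refl
K₄-∨-distʳ ka kb k0 = refl
K₄-∨-distʳ ka kb kb = refl
K₄-∨-distʳ ka kb ka = refl
K₄-∨-distʳ ka kb k1 = refl
K₄-∨-distʳ ka ka k0 = refl
K₄-∨-distʳ ka ka kb = refl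
K₄-∨-distʳ ka ka ka = refl
K₄-∨-distʳ ka ka k1 = refl
K₄-∨-distʳ ka k1 k0 = refl
K₄-∨-distʳ ka k1 kb = refl
K₄-∨-distʳ ka k1 ka = refl
K₄-∨-distʳ ka k1 k1 = refl
K₄-∨-distʳ k1 k0 k0 = refl
K₄-∨-distʳ k1 k0 kb = refl
K₄-∨-distʳ k1 k0 ka = refl
K₄-∨-distʳ k1 k0 k1 = refl
K₄-∨-distʳ k1 kb k0 = refl
K₄-∨-distʳ k1 kb kb = refl
K₄-∨-distʳ k1 kb ka = refl
K₄-∨-distʳ k1 kb k1 = refl
K₄-∨-distʳ k1 ka k0 = refl
K₄-∨-distʳ k1 ka kb = refl
K₄-∨-distʳ k1 ka ka = refl
K₄-∨-distʳ k1 ka k1 = refl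
K₄-∨-distʳ k1 k1 k0 = refl
K₄-∨-distʳ k1 k1 kb = refl
K₄-∨-distʳ k1 k1 ka = refl
K₄-∨-distʳ k1 k1 k1 = refl
K₄-∧-distˡ : (x y z : K₄-El) → K₄-∧ x (K₄-∨ y z) ≡ K₄-∨ (K₄-∧ x y) (K₄-∧ x z)
K₄-∧-distˡ k0 k0 k0 = refl
K₄-∧-distˡ k0 k0 kb = refl
K₄-∧-distˡ k0 k0 ka = refl
K₄-∧-distˡ k0 k0 k1 = refl
K₄-∧-distˡ k0 kb k0 = refl
K₄-∧-distˡ k0 kb kb = refl
K₄-∧-distˡ k0 kb ka = refl
K₄-∧-distˡ k0 kb k1 = refl
K₄-∧-distˡ k0 ka k0 = refl
K₄-∧-distˡ k0 ka kb = refl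
K₄-∧-distˡ k0 ka ka = refl
K₄-∧-distˡ k0 ka k1 = refl
K₄-∧-distˡ k0 k1 k0 = refl
K₄-∧-distˡ k0 k1 kb = refl
K₄-∧-distˡ k0 k1 ka = refl
K₄-∧-distˡ k0 k1 k1 = refl
K₄-∧-distˡ kb k0 k0 = refl
K₄-∧-distˡ kb k0 kb = refl
K₄-∧-distˡ kb k0 ka = refl
K₄-∧-distˡ kb k0 k1 = refl
K₄-∧-distˡ kb kb k0 = refl
K₄-∧-distˡ kb kb kb = refl
K₄-∧-distˡ kb kb ka = refl
K₄-∧-distˡ kb kb k1 = refl
K₄-∧-distˡ kb ka k0 = refl
K₄-∧-distˡ kb ka kb = refl
K₄-∧-distˡ kb ka ka = refl
K₄-∧-distˡ kb ka k1 = refl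
K₄-∧-distˡ kb k1 k0 = refl
K₄-∧-distˡ kb k1 kb = refl
K₄-∧-distˡ kb k1 ka = refl
K₄-∧-distˡ kb k1 k1 = refl
K₄-∧-distˡ ka k0 k0 = refl
K₄-∧-distˡ ka k0 kb = refl
K₄-∧-distˡ ka k0 ka = refl
K₄-∧-distˡ ka k0 k1 = refl
K₄-∧-distˡ ka kb k0 = refl
K₄-∧-distˡ ka kb kb = refl
K₄-∧-distˡ ka kb ka = refl
K₄-∧-distˡ ka kb k1 = refl
K₄-∧-distˡ ka ka k0 = refl
K₄-∧-distˡ ka ka kb = refl
K₄-∧-distˡ ka ka ka = refl
K₄-∧-distˡ ka ka k1 = refl
K₄-∧-distˡ ka k1 k0 = refl
K₄-∧-distˡ ka k1 kb = refl
K₄-∧-distˡ ka k1 ka = refl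
K₄-∧-distˡ ka k1 k1 = refl
K₄-∧-distˡ k1 k0 k0 = refl
K₄-∧-distˡ k1 k0 kb = refl
K₄-∧-distˡ k1 k0 ka = refl
K₄-∧-distˡ k1 k0 k1 = refl
K₄-∧-distˡ k1 kb k0 = refl
K₄-∧-distˡ k1 kb kb = refl
K₄-∧-distˡ k1 kb ka = refl
K₄-∧-distˡ k1 kb k1 = refl
K₄-∧-distˡ k1 ka k0 = refl
K₄-∧-distˡ k1 ka kb = refl
K₄-∧-distˡ k1 ka ka = refl
K₄-∧-distˡ k1 ka k1 = refl
K₄-∧-distˡ k1 k1 k0 = refl
K₄-∧-distˡ k1 k1 kb = refl
K₄-∧-distˡ k1 k1 ka = refl
K₄-∧-distˡ k1 k1 k1 = refl
K₄-∧-distʳ : (x y z : K₄-El) → K₄-∧ (K₄-∨ y z) x ≡ K₄-∨ (K₄-∧ y x) (K₄-∧ z x)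
K₄-∧-distʳ k0 k0 k0 = refl
K₄-∧-distʳ k0 k0 kb = refl
K₄-∧-distʳ k0 k0 ka = refl
K₄-∧-distʳ k0 k0 k1 = refl
K₄-∧-distʳ k0 kb k0 = refl
K₄-∧-distʳ k0 kb kb = refl
K₄-∧-distʳ k0 kb ka = refl
K₄-∧-distʳ k0 kb k1 = refl
K₄-∧-distʳ k0 ka k0 = refl
K₄-∧-distʳ k0 ka kb = refl
K₄-∧-distʳ k0 ka ka = refl
K₄-∧-distʳ k0 ka k1 = refl
K₄-∧-distʳ k0 k1 k0 = refl
K₄-∧-distʳ k0 k1 kb = refl
K₄-∧-distʳ k0 k1 ka = refl
K₄-∧-distʳ k0 k1 k1 = refl
K₄-∧-distʳ kb k0 k0 = refl
K₄-∧-distʳ kb k0 kb = refl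
K₄-∧-distʳ kb k0 ka = refl
K₄-∧-distʳ kb k0 k1 = refl
K₄-∧-distʳ kb kb k0 = refl
K₄-∧-distʳ kb kb kb = refl
K₄-∧-distʳ kb kb ka = refl
K₄-∧-distʳ kb kb k1 = refl
K₄-∧-distʳ kb ka k0 = refl
K₄-∧-distʳ kb ka kb = refl
K₄-∧-distʳ kb ka ka = refl
K₄-∧-distʳ kb ka k1 = refl
K₄-∧-distʳ kb k1 k0 = refl
K₄-∧-distʳ kb k1 kb = refl
K₄-∧-distʳ kb k1 ka = refl
K₄-∧-distʳ kb k1 k1 = refl
K₄-∧-distʳ ka k0 k0 = refl
K₄-∧-distʳ ka k0 kb = refl
K₄-∧-distʳ ka k0 ka = refl
K₄-∧-distʳ ka k0 k1 = refl
K₄-∧-distʳ ka kb k0 = refl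
K₄-∧-distʳ ka kb kb = refl
K₄-∧-distʳ ka kb ka = refl
K₄-∧-distʳ ka kb k1 = refl
K₄-∧-distʳ ka ka k0 = refl
K₄-∧-distʳ ka ka kb = refl
K₄-∧-distʳ ka ka ka = refl
K₄-∧-distʳ ka ka k1 = refl
K₄-∧-distʳ ka k1 k0 = refl
K₄-∧-distʳ ka k1 kb = refl
K₄-∧-distʳ ka k1 ka = refl
K₄-∧-distʳ ka k1 k1 = refl
K₄-∧-distʳ k1 k0 k0 = refl
K₄-∧-distʳ k1 k0 kb = refl
K₄-∧-distʳ k1 k0 ka = refl
K₄-∧-distʳ k1 k0 k1 = refl
K₄-∧-distʳ k1 kb k0 = refl
K₄-∧-distʳ k1 kb kb = refl
K₄-∧-distʳ k1 kb ka = refl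
K₄-∧-distʳ k1 kb k1 = refl
K₄-∧-distʳ k1 ka k0 = refl
K₄-∧-distʳ k1 ka kb = refl
K₄-∧-distʳ k1 ka ka = refl
K₄-∧-distʳ k1 ka k1 = refl
K₄-∧-distʳ k1 k1 k0 = refl
K₄-∧-distʳ k1 k1 kb = refl
K₄-∧-distʳ k1 k1 ka = refl
K₄-∧-distʳ k1 k1 k1 = refl
K₄-∨-idˡ : (x : K₄-El) → K₄-∨ k0 x ≡ x
K₄-∨-idˡ k0 = refl
K₄-∨-idˡ kb = refl
K₄-∨-idˡ ka = refl
K₄-∨-idˡ k1 = refl
K₄-∨-idʳ : (x : K₄-El) → K₄-∨ x k0 ≡ x
K₄-∨-idʳ k0 = refl
K₄-∨-idʳ kb = refl
K₄-∨-idʳ ka = refl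
K₄-∨-idʳ k1 = refl
K₄-∧-idˡ : (x : K₄-El) → K₄-∧ k1 x ≡ x
K₄-∧-idˡ k0 = refl
K₄-∧-idˡ kb = refl
K₄-∧-idˡ ka = refl
K₄-∧-idˡ k1 = refl
K₄-∧-idʳ : (x : K₄-El) → K₄-∧ x k1 ≡ x
K₄-∧-idʳ k0 = refl
K₄-∧-idʳ kb = refl
K₄-∧-idʳ ka = refl
K₄-∧-idʳ k1 = refl
K₄-¬¬ : (x : K₄-El) → K₄-¬ (K₄-¬ x) ≡ x
K₄-¬¬ k0 = refl
K₄-¬¬ kb = refl
K₄-¬¬ ka = refl
K₄-¬¬ k1 = refl
K₄-deMorgan : (x y : K₄-El) → K₄-∧ x y ≡ K₄-¬ (K₄-∨ (K₄-¬ x) (K₄-¬ y))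
K₄-deMorgan k0 k0 = refl
K₄-deMorgan k0 kb = refl
K₄-deMorgan k0 ka = refl
K₄-deMorgan k0 k1 = refl
K₄-deMorgan kb k0 = refl
K₄-deMorgan kb kb = refl
K₄-deMorgan kb ka = refl
K₄-deMorgan kb k1 = refl
K₄-deMorgan ka k0 = refl
K₄-deMorgan ka kb = refl
K₄-deMorgan ka ka = refl
K₄-deMorgan ka k1 = refl
K₄-deMorgan k1 k0 = refl
K₄-deMorgan k1 kb = refl
K₄-deMorgan k1 ka = refl
K₄-deMorgan k1 k1 = refl
K₄-kleene : (x y : K₄-El) → K₄-∧ (K₄-∧ x (K₄-¬ x)) (K₄-∨ y (K₄-¬ y)) ≡ K₄-∧ x (K₄-¬ x)
K₄-kleene k0 k0 = refl
K₄-kleene k0 kb = refl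
K₄-kleene k0 ka = refl
K₄-kleene k0 k1 = refl
K₄-kleene kb k0 = refl
K₄-kleene kb kb = refl
K₄-kleene kb ka = refl
K₄-kleene kb k1 = refl
K₄-kleene ka k0 = refl
K₄-kleene ka kb = refl
K₄-kleene ka ka = refl
K₄-kleene ka k1 = refl
K₄-kleene k1 k0 = refl
K₄-kleene k1 kb = refl
K₄-kleene k1 ka = refl
K₄-kleene k1 k1 = refl

K₄ : KleeneAlgebra 0ℓ 0ℓ
K₄ = record
  { Carrier = K₄-El ; _≈_ = _≡_ ; _∧_ = K₄-∧ ; _∨_ = K₄-∨ ; ¬_ = K₄-¬
  ; 0# = k0 ; 1# = k1
  ; isKleeneAlgebra = record
    { isDistributiveLattice = record
      { isLattice = record
        { isEquivalence = P.isEquivalence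
        ; ∨-comm = K₄-∨-comm ; ∨-assoc = K₄-∨-assoc ; ∨-cong = P.cong₂ K₄-∨
        ; ∧-comm = K₄-∧-comm ; ∧-assoc = K₄-∧-assoc ; ∧-cong = P.cong₂ K₄-∧
        ; absorptive = K₄-∨-abs , K₄-∧-abs
        }
      ; ∨-distrib-∧ = K₄-∨-distˡ , K₄-∨-distʳ
      ; ∧-distrib-∨ = K₄-∧-distˡ , K₄-∧-distʳ
      }
    ; ¬-cong = P.cong K₄-¬
    ; ∨-identity = K₄-∨-idˡ , K₄-∨-idʳ
    ; ∧-identity = K₄-∧-idˡ , K₄-∧-idʳ
    ; ¬-involutive = K₄-¬¬
    ; deMorgan = K₄-deMorgan
    ; kleene = K₄-kleene
    }
  }

data 𝟚KA-El : Set where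
  t0 t1 : 𝟚KA-El

𝟚KA-∧ : 𝟚KA-El → 𝟚KA-El → 𝟚KA-El
𝟚KA-∧ t0 t0 = t0
𝟚KA-∧ t0 t1 = t0
𝟚KA-∧ t1 t0 = t0
𝟚KA-∧ t1 t1 = t1
𝟚KA-∨ : 𝟚KA-El → 𝟚KA-El → 𝟚KA-El
𝟚KA-∨ t0 t0 = t0
𝟚KA-∨ t0 t1 = t1
𝟚KA-∨ t1 t0 = t1
𝟚KA-∨ t1 t1 = t1
𝟚KA-¬ : 𝟚KA-El → 𝟚KA-El
𝟚KA-¬ t0 = t1
𝟚KA-¬ t1 = t0

𝟚KA-∨-comm : (x y : 𝟚KA-El) → 𝟚KA-∨ x y ≡ 𝟚KA-∨ y x
𝟚KA-∨-comm t0 t0 = refl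
𝟚KA-∨-comm t0 t1 = refl
𝟚KA-∨-comm t1 t0 = refl
𝟚KA-∨-comm t1 t1 = refl
𝟚KA-∧-comm : (x y : 𝟚KA-El) → 𝟚KA-∧ x y ≡ 𝟚KA-∧ y x
𝟚KA-∧-comm t0 t0 = refl
𝟚KA-∧-comm t0 t1 = refl
𝟚KA-∧-comm t1 t0 = refl
𝟚KA-∧-comm t1 t1 = refl
𝟚KA-∨-assoc : (x y z : 𝟚KA-El) → 𝟚KA-∨ (𝟚KA-∨ x y) z ≡ 𝟚KA-∨ x (𝟚KA-∨ y z)
𝟚KA-∨-assoc t0 t0 t0 = refl
𝟚KA-∨-assoc t0 t0 t1 = refl
𝟚KA-∨-assoc t0 t1 t0 = refl
𝟚KA-∨-assoc t0 t1 t1 = refl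
𝟚KA-∨-assoc t1 t0 t0 = refl
𝟚KA-∨-assoc t1 t0 t1 = refl
𝟚KA-∨-assoc t1 t1 t0 = refl
𝟚KA-∨-assoc t1 t1 t1 = refl
𝟚KA-∧-assoc : (x y z : 𝟚KA-El) → 𝟚KA-∧ (𝟚KA-∧ x y) z ≡ 𝟚KA-∧ x (𝟚KA-∧ y z)
𝟚KA-∧-assoc t0 t0 t0 = refl
𝟚KA-∧-assoc t0 t0 t1 = refl
𝟚KA-∧-assoc t0 t1 t0 = refl
𝟚KA-∧-assoc t0 t1 t1 = refl
𝟚KA-∧-assoc t1 t0 t0 = refl
𝟚KA-∧-assoc t1 t0 t1 = refl
𝟚KA-∧-assoc t1 t1 t0 = refl
𝟚KA-∧-assoc t1 t1 t1 = refl
𝟚KA-∨-abs : (x y : 𝟚KA-El) → 𝟚KA-∨ x (𝟚KA-∧ x y) ≡ x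
𝟚KA-∨-abs t0 t0 = refl
𝟚KA-∨-abs t0 t1 = refl
𝟚KA-∨-abs t1 t0 = refl
𝟚KA-∨-abs t1 t1 = refl
𝟚KA-∧-abs : (x y : 𝟚KA-El) → 𝟚KA-∧ x (𝟚KA-∨ x y) ≡ x
𝟚KA-∧-abs t0 t0 = refl
𝟚KA-∧-abs t0 t1 = refl
𝟚KA-∧-abs t1 t0 = refl
𝟚KA-∧-abs t1 t1 = refl
𝟚KA-∨-distˡ : (x y z : 𝟚KA-El) → 𝟚KA-∨ x (𝟚KA-∧ y z) ≡ 𝟚KA-∧ (𝟚KA-∨ x y) (𝟚KA-∨ x z)
𝟚KA-∨-distˡ t0 t0 t0 = refl
𝟚KA-∨-distˡ t0 t0 t1 = refl
𝟚KA-∨-distˡ t0 t1 t0 = refl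
𝟚KA-∨-distˡ t0 t1 t1 = refl
𝟚KA-∨-distˡ t1 t0 t0 = refl
𝟚KA-∨-distˡ t1 t0 t1 = refl
𝟚KA-∨-distˡ t1 t1 t0 = refl
𝟚KA-∨-distˡ t1 t1 t1 = refl
𝟚KA-∨-distʳ : (x y z : 𝟚KA-El) → 𝟚KA-∨ (𝟚KA-∧ y z) x ≡ 𝟚KA-∧ (𝟚KA-∨ y x) (𝟚KA-∨ z x)
𝟚KA-∨-distʳ t0 t0 t0 = refl
𝟚KA-∨-distʳ t0 t0 t1 = refl
𝟚KA-∨-distʳ t0 t1 t0 = refl
𝟚KA-∨-distʳ t0 t1 t1 = refl
𝟚KA-∨-distʳ t1 t0 t0 = refl
𝟚KA-∨-distʳ t1 t0 t1 = refl
𝟚KA-∨-distʳ t1 t1 t0 = refl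
𝟚KA-∨-distʳ t1 t1 t1 = refl
𝟚KA-∧-distˡ : (x y z : 𝟚KA-El) → 𝟚KA-∧ x (𝟚KA-∨ y z) ≡ 𝟚KA-∨ (𝟚KA-∧ x y) (𝟚KA-∧ x z)
𝟚KA-∧-distˡ t0 t0 t0 = refl
𝟚KA-∧-distˡ t0 t0 t1 = refl
𝟚KA-∧-distˡ t0 t1 t0 = refl
𝟚KA-∧-distˡ t0 t1 t1 = refl
𝟚KA-∧-distˡ t1 t0 t0 = refl
𝟚KA-∧-distˡ t1 t0 t1 = refl
𝟚KA-∧-distˡ t1 t1 t0 = refl
𝟚KA-∧-distˡ t1 t1 t1 = refl
𝟚KA-∧-distʳ : (x y z : 𝟚KA-El) → 𝟚KA-∧ (𝟚KA-∨ y z) x ≡ 𝟚KA-∨ (𝟚KA-∧ y x) (𝟚KA-∧ z x)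
𝟚KA-∧-distʳ t0 t0 t0 = refl
𝟚KA-∧-distʳ t0 t0 t1 = refl
𝟚KA-∧-distʳ t0 t1 t0 = refl
𝟚KA-∧-distʳ t0 t1 t1 = refl
𝟚KA-∧-distʳ t1 t0 t0 = refl
𝟚KA-∧-distʳ t1 t0 t1 = refl
𝟚KA-∧-distʳ t1 t1 t0 = refl
𝟚KA-∧-distʳ t1 t1 t1 = refl
𝟚KA-∨-idˡ : (x : 𝟚KA-El) → 𝟚KA-∨ t0 x ≡ x
𝟚KA-∨-idˡ t0 = refl
𝟚KA-∨-idˡ t1 = refl
𝟚KA-∨-idʳ : (x : 𝟚KA-El) → 𝟚KA-∨ x t0 ≡ x
𝟚KA-∨-idʳ t0 = refl
𝟚KA-∨-idʳ t1 = refl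
𝟚KA-∧-idˡ : (x : 𝟚KA-El) → 𝟚KA-∧ t1 x ≡ x
𝟚KA-∧-idˡ t0 = refl
𝟚KA-∧-idˡ t1 = refl
𝟚KA-∧-idʳ : (x : 𝟚KA-El) → 𝟚KA-∧ x t1 ≡ x
𝟚KA-∧-idʳ t0 = refl
𝟚KA-∧-idʳ t1 = refl
𝟚KA-¬¬ : (x : 𝟚KA-El) → 𝟚KA-¬ (𝟚KA-¬ x) ≡ x
𝟚KA-¬¬ t0 = refl
𝟚KA-¬¬ t1 = refl
𝟚KA-deMorgan : (x y : 𝟚KA-El) → 𝟚KA-∧ x y ≡ 𝟚KA-¬ (𝟚KA-∨ (𝟚KA-¬ x) (𝟚KA-¬ y))
𝟚KA-deMorgan t0 t0 = refl
𝟚KA-deMorgan t0 t1 = refl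
𝟚KA-deMorgan t1 t0 = refl
𝟚KA-deMorgan t1 t1 = refl
𝟚KA-kleene : (x y : 𝟚KA-El) → 𝟚KA-∧ (𝟚KA-∧ x (𝟚KA-¬ x)) (𝟚KA-∨ y (𝟚KA-¬ y)) ≡ 𝟚KA-∧ x (𝟚KA-¬ x)
𝟚KA-kleene t0 t0 = refl
𝟚KA-kleene t0 t1 = refl
𝟚KA-kleene t1 t0 = refl
𝟚KA-kleene t1 t1 = refl

𝟚KA : KleeneAlgebra 0ℓ 0ℓ
𝟚KA = record
  { Carrier = 𝟚KA-El ; _≈_ = _≡_ ; _∧_ = 𝟚KA-∧ ; _∨_ = 𝟚KA-∨ ; ¬_ = 𝟚KA-¬
  ; 0# = t0 ; 1# = t1
  ; isKleeneAlgebra = record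
    { isDistributiveLattice = record
      { isLattice = record
        { isEquivalence = P.isEquivalence
        ; ∨-comm = 𝟚KA-∨-comm ; ∨-assoc = 𝟚KA-∨-assoc ; ∨-cong = P.cong₂ 𝟚KA-∨
        ; ∧-comm = 𝟚KA-∧-comm ; ∧-assoc = 𝟚KA-∧-assoc ; ∧-cong = P.cong₂ 𝟚KA-∧
        ; absorptive = 𝟚KA-∨-abs , 𝟚KA-∧-abs
        }
      ; ∨-distrib-∧ = 𝟚KA-∨-distˡ , 𝟚KA-∨-distʳ
      ; ∧-distrib-∨ = 𝟚KA-∧-distˡ , 𝟚KA-∧-distʳ
      }
    ; ¬-cong = P.cong 𝟚KA-¬
    ; ∨-identity = 𝟚KA-∨-idˡ , 𝟚KA-∨-idʳ
    ; ∧-identity = 𝟚KA-∧-idˡ , 𝟚KA-∧-idʳ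
    ; ¬-involutive = 𝟚KA-¬¬
    ; deMorgan = 𝟚KA-deMorgan
    ; kleene = 𝟚KA-kleene
    }
  }

-- Let a generate A and let an embedding h put A inside the free algebra on n generators; write
-- p = h a. Evaluating p at the point of K₄ⁿ all of whose coordinates are ka decides whether p is the
-- constant 0 or 1, and then A ≅ 2. Otherwise look at the Boolean values of p. If p takes both values,
-- then the values of a one-variable term at z = 0, at a middle point of K₄ and at z = 1 determine it
-- among the six elements of F(z), so a satisfies no equation that z does not, and A ≅ F(z). If p is
-- never 1, then p ≤ ¬ p holds in every Kleene algebra: this goes by induction on the number of
-- variables, through the Kleene form t(x) ≤ (x ∨ t(0)) ∧ (¬ x ∨ t(1)) of Shannon's expansion and the
-- Kleene axiom, which makes the elements below their negation closed under joins. Then a ↦ kb gives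
-- A ≅ K₄, and dually a ↦ ka when p is never 0. Conversely, F(z), K₄ (via kb ↦ z ∧ ¬ z) and 2 (as
-- the closed terms) are retracts of free algebras, which gives projectivity and exactness at once.
module Submission where

open import Defs
open import Level using (Level; _⊔_)
open import Data.Product using (Σ; _×_; _,_; proj₁; proj₂)
open import Data.Sum using (_⊎_; inj₁; inj₂)
open import Data.Nat using (zero; suc)
open import Data.Fin using (Fin; zero; suc)
open import Data.Vec.Functional using (_∷_; tail)
open import Data.Bool using (Bool; true; false)
open import Data.Vec using (lookup; tabulate)
open import Data.Vec.Properties using (lookup∘tabulate)
open import Data.Fin.Subset using (Subset)
open import Data.Fin.Subset.Properties using (anySubset?)
open import Data.Empty using (⊥; ⊥-elim)
open import Relation.Nullary using (Dec; yes; no)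
open import Relation.Nullary.Decidable using (map′)
open import Relation.Binary.Definitions using (DecidableEquality)
open import Relation.Binary.PropositionalEquality as ≡ using (_≡_)
open import Function.Bundles using (_⇔_; mk⇔)
open import Algebra.Lattice.Bundles using (DistributiveLattice)
open import Algebra.Lattice.Structures using (IsDistributiveLattice)
import Algebra.Lattice.Properties.Lattice as LatticeProperties
import Relation.Binary.Lattice.Bundles as Order
import Relation.Binary.Lattice.Properties.MeetSemilattice as MeetProperties
import Relation.Binary.Lattice.Properties.JoinSemilattice as JoinProperties
import Relation.Binary.Reasoning.PartialOrder as ≤-Reasoning
open import Algebra.Bundles using (CommutativeSemigroup)
open import Algebra.Structures using (IsCommutativeBand)
import Algebra.Properties.CommutativeSemigroup as CommutativeSemigroupProperties

module KleeneProperties {c ℓ} (B : KleeneAlgebra c ℓ) where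
  open KleeneAlgebra B public hiding (_≤_)
  open IsDistributiveLattice isDistributiveLattice public

  distributiveLattice : DistributiveLattice c ℓ
  distributiveLattice = record { isDistributiveLattice = isDistributiveLattice }

  open LatticeProperties (DistributiveLattice.lattice distributiveLattice) public
    using (∧-isSemilattice; ∨-∧-orderTheoreticLattice)
  -- Beware: this _≤_ is x ≈ x ∧ y, so an inequality can be used directly as an equation.
  open Order.Lattice ∨-∧-orderTheoreticLattice public
    using (_≤_; poset; x≤x∨y; y≤x∨y; ∨-least; x∧y≤x; x∧y≤y; ∧-greatest)
    renaming (refl to ≤-refl; trans to ≤-trans; reflexive to ≈⇒≤)
  open MeetProperties (Order.Lattice.meetSemilattice ∨-∧-orderTheoreticLattice) public
    using (∧-monotonic)
  open JoinProperties (Order.Lattice.joinSemilattice ∨-∧-orderTheoreticLattice) public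
    using (∨-monotonic; x≤y⇒x∨y≈y)
  open ≤-Reasoning poset public

  ∧-commutativeSemigroup : CommutativeSemigroup c ℓ
  ∧-commutativeSemigroup = record
    { isCommutativeSemigroup = IsCommutativeBand.isCommutativeSemigroup ∧-isSemilattice }

  open CommutativeSemigroupProperties ∧-commutativeSemigroup public
    using () renaming (interchange to ∧-interchange)

  ∨-identityˡ : ∀ x → 0# ∨ x ≈ x
  ∨-identityˡ = proj₁ ∨-identity

  ∧-identityʳ : ∀ x → x ∧ 1# ≈ x
  ∧-identityʳ = proj₂ ∧-identity

  0≤ : ∀ x → 0# ≤ x
  0≤ x = sym (begin-equality
    0# ∧ x          ≈⟨ ∧-congˡ (∨-identityˡ x) ⟨
    0# ∧ (0# ∨ x)   ≈⟨ ∧-absorbs-∨ 0# x ⟩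
    0#              ∎)

  ≤1 : ∀ x → x ≤ 1#
  ≤1 x = sym (∧-identityʳ x)

  ≥⇒≈∧ : ∀ {x y} → y ≤ x → y ≈ x ∧ y
  ≥⇒≈∧ {x} {y} y≤x = trans y≤x (∧-comm y x)

  ¬-distrib-∧ : ∀ x y → ¬ (x ∧ y) ≈ ¬ x ∨ ¬ y
  ¬-distrib-∧ x y = trans (¬-cong (deMorgan x y)) (¬-involutive _)

  ¬-distrib-∨ : ∀ x y → ¬ (x ∨ y) ≈ ¬ x ∧ ¬ y
  ¬-distrib-∨ x y = sym (begin-equality
    ¬ x ∧ ¬ y               ≈⟨ deMorgan (¬ x) (¬ y) ⟩
    ¬ (¬ ¬ x ∨ ¬ ¬ y)       ≈⟨ ¬-cong (∨-cong (¬-involutive x) (¬-involutive y)) ⟩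
    ¬ (x ∨ y)               ∎)

  ∨-via-∧ : ∀ x y → x ∨ y ≈ ¬ (¬ x ∧ ¬ y)
  ∨-via-∧ x y = sym (trans (¬-distrib-∧ (¬ x) (¬ y)) (∨-cong (¬-involutive x) (¬-involutive y)))

  ¬0≈1 : ¬ 0# ≈ 1#
  ¬0≈1 = begin-equality
    ¬ 0#              ≈⟨ ¬-cong (0≤ (¬ 1#)) ⟩
    ¬ (0# ∧ ¬ 1#)     ≈⟨ ¬-distrib-∧ 0# (¬ 1#) ⟩
    ¬ 0# ∨ ¬ ¬ 1#     ≈⟨ ∨-congˡ (¬-involutive 1#) ⟩
    ¬ 0# ∨ 1#         ≈⟨ x≤y⇒x∨y≈y (≤1 (¬ 0#)) ⟩
    1#                ∎

  ¬1≈0 : ¬ 1# ≈ 0#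
  ¬1≈0 = trans (¬-cong (sym ¬0≈1)) (¬-involutive 0#)

  ¬-antitone : ∀ {x y} → x ≤ y → ¬ y ≤ ¬ x
  ¬-antitone {x} {y} x≤y = begin
    ¬ y          ≤⟨ y≤x∨y (¬ x) (¬ y) ⟩
    ¬ x ∨ ¬ y    ≈⟨ ¬-distrib-∧ x y ⟨
    ¬ (x ∧ y)    ≈⟨ ¬-cong x≤y ⟨
    ¬ x          ∎

  Small : Carrier → Set ℓ
  Small x = x ≤ ¬ x

  small-resp-≈ : ∀ {x y} → x ≈ y → Small x → Small y
  small-resp-≈ {x} {y} x≈y small = begin
    y     ≈⟨ x≈y ⟨
    x     ≤⟨ small ⟩
    ¬ x   ≈⟨ ¬-cong x≈y ⟩
    ¬ y   ∎

  small-downward : ∀ {x y} → x ≤ y → Small y → Small x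
  small-downward {x} {y} x≤y small = begin
    x     ≤⟨ x≤y ⟩
    y     ≤⟨ small ⟩
    ¬ y   ≤⟨ ¬-antitone x≤y ⟩
    ¬ x   ∎

  small-x∧¬x : ∀ x → Small (x ∧ ¬ x)
  small-x∧¬x x = begin
    x ∧ ¬ x          ≤⟨ x∧y≤y x (¬ x) ⟩
    ¬ x              ≤⟨ x≤x∨y (¬ x) (¬ ¬ x) ⟩
    ¬ x ∨ ¬ ¬ x      ≈⟨ ¬-distrib-∧ x (¬ x) ⟨
    ¬ (x ∧ ¬ x)      ∎

  small≤¬small : ∀ {x y} → Small x → Small y → x ≤ ¬ y
  small≤¬small {x} {y} sx sy = begin
    x                        ≤⟨ ∧-greatest ≤-refl x≤y∨¬y ⟩
    x ∧ (y ∨ ¬ y)            ≈⟨ ∧-distribˡ-∨ x y (¬ y) ⟩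
    (x ∧ y) ∨ (x ∧ ¬ y)      ≤⟨ ∨-least (≤-trans (x∧y≤y x y) sy) (x∧y≤y x (¬ y)) ⟩
    ¬ y                      ∎
    where
    x≤y∨¬y : x ≤ y ∨ ¬ y
    x≤y∨¬y = begin
      x           ≤⟨ ∧-greatest ≤-refl sx ⟩
      x ∧ ¬ x     ≈⟨ kleene x y ⟨
      (x ∧ ¬ x) ∧ (y ∨ ¬ y) ≤⟨ x∧y≤y _ _ ⟩
      y ∨ ¬ y     ∎

  small-∨ : ∀ {x y} → Small x → Small y → Small (x ∨ y)
  small-∨ {x} {y} sx sy = begin
    x ∨ y          ≤⟨ ∨-least (∧-greatest sx (small≤¬small sx sy)) (∧-greatest (small≤¬small sy sx) sy) ⟩
    ¬ x ∧ ¬ y      ≈⟨ ¬-distrib-∨ x y ⟨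
    ¬ (x ∨ y)      ∎

  -- Expanding, (x ∨ a) ∧ (¬ x ∨ b) ≈ (x ∧ ¬ x) ∨ (x ∧ b) ∨ (a ∧ ¬ x) ∨ (a ∧ b): Boole–Shannon's
  -- (x ∧ b) ∨ (¬ x ∧ a) together with the error terms a Kleene algebra cannot avoid.
  shannon : Carrier → Carrier → Carrier → Carrier
  shannon x a b = (x ∨ a) ∧ (¬ x ∨ b)

  shannon-cong : ∀ {x a a′ b b′} → a ≈ a′ → b ≈ b′ → shannon x a b ≈ shannon x a′ b′
  shannon-cong a≈a′ b≈b′ = ∧-cong (∨-congˡ a≈a′) (∨-congˡ b≈b′)

  shannon-monotone : ∀ {x a a′ b b′} → a ≤ a′ → b ≤ b′ → shannon x a b ≤ shannon x a′ b′
  shannon-monotone a≤a′ b≤b′ = ∧-monotonic (∨-monotonic ≤-refl a≤a′) (∨-monotonic ≤-refl b≤b′)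

  ≤-shannon-diagonal : ∀ x y → y ≤ shannon x y y
  ≤-shannon-diagonal x y = ∧-greatest (y≤x∨y x y) (y≤x∨y (¬ x) y)

  shannon-∧ : ∀ x a b a′ b′ → shannon x a b ∧ shannon x a′ b′ ≈ shannon x (a ∧ a′) (b ∧ b′)
  shannon-∧ x a b a′ b′ = begin-equality
    ((x ∨ a) ∧ (¬ x ∨ b)) ∧ ((x ∨ a′) ∧ (¬ x ∨ b′))   ≈⟨ ∧-interchange _ _ _ _ ⟩
    ((x ∨ a) ∧ (x ∨ a′)) ∧ ((¬ x ∨ b) ∧ (¬ x ∨ b′))   ≈⟨ ∧-cong (∨-distribˡ-∧ x a a′) (∨-distribˡ-∧ (¬ x) b b′) ⟨
    (x ∨ (a ∧ a′)) ∧ (¬ x ∨ (b ∧ b′))                 ∎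

  shannon-∨ : ∀ x a b a′ b′ → shannon x a b ∨ shannon x a′ b′ ≤ shannon x (a ∨ a′) (b ∨ b′)
  shannon-∨ x a b a′ b′ = ∨-least (shannon-monotone (x≤x∨y a a′) (x≤x∨y b b′))
                                  (shannon-monotone (y≤x∨y a a′) (y≤x∨y b b′))

  small-shannon : ∀ x {a b} → Small a → Small b → Small (shannon x a b)
  small-shannon x {a} {b} sa sb = small-resp-≈ (sym expand)
    (small-∨ (small-∨ (small-x∧¬x x) (small-downward (x∧y≤y x b) sb))
             (small-∨ (small-downward (x∧y≤x a (¬ x)) sa) (small-downward (x∧y≤x a b) sa)))
    where
    expand : shannon x a b ≈ ((x ∧ ¬ x) ∨ (x ∧ b)) ∨ ((a ∧ ¬ x) ∨ (a ∧ b))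
    expand = trans (∧-distribʳ-∨ (¬ x ∨ b) x a)
                   (∨-cong (∧-distribˡ-∨ x (¬ x) b) (∧-distribˡ-∨ a (¬ x) b))

module Evaluation {c ℓ} (B : KleeneAlgebra c ℓ) where
  open KleeneProperties B

  eval-cong : ∀ {a} {X : Set a} (v : X → Carrier) {t u : Term X} → t ~ u → eval B v t ≈ eval B v u
  eval-cong v ~refl                 = refl
  eval-cong v (~sym t~u)            = sym (eval-cong v t~u)
  eval-cong v (~trans t~u u~w)      = trans (eval-cong v t~u) (eval-cong v u~w)
  eval-cong v (∧-cg t~t′ u~u′)      = ∧-cong (eval-cong v t~t′) (eval-cong v u~u′)
  eval-cong v (∨-cg t~t′ u~u′)      = ∨-cong (eval-cong v t~t′) (eval-cong v u~u′)
  eval-cong v (¬-cg t~t′)           = ¬-cong (eval-cong v t~t′)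
  eval-cong v (∨-comm-ax _ _)       = ∨-comm _ _
  eval-cong v (∧-comm-ax _ _)       = ∧-comm _ _
  eval-cong v (∨-assoc-ax _ _ _)    = ∨-assoc _ _ _
  eval-cong v (∧-assoc-ax _ _ _)    = ∧-assoc _ _ _
  eval-cong v (∨-abs-ax _ _)        = ∨-absorbs-∧ _ _
  eval-cong v (∧-abs-ax _ _)        = ∧-absorbs-∨ _ _
  eval-cong v (∧-distˡ-ax _ _ _)    = ∧-distribˡ-∨ _ _ _
  eval-cong v (∨-distˡ-ax _ _ _)    = ∨-distribˡ-∧ _ _ _
  eval-cong v (∨-id-ax _)           = proj₂ ∨-identity _
  eval-cong v (∧-id-ax _)           = ∧-identityʳ _
  eval-cong v (¬¬-ax _)             = ¬-involutive _
  eval-cong v (deMorgan-ax _ _)     = deMorgan _ _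
  eval-cong v (kleene-ax _ _)       = kleene _ _

  eval-≗ : ∀ {a} {X : Set a} {v w : X → Carrier} → (∀ x → v x ≈ w x) → ∀ t → eval B v t ≈ eval B w t
  eval-≗ v≈w (var x)  = v≈w x
  eval-≗ v≈w (t ∧' u) = ∧-cong (eval-≗ v≈w t) (eval-≗ v≈w u)
  eval-≗ v≈w (t ∨' u) = ∨-cong (eval-≗ v≈w t) (eval-≗ v≈w u)
  eval-≗ v≈w (¬' t)   = ¬-cong (eval-≗ v≈w t)
  eval-≗ v≈w 0'       = refl
  eval-≗ v≈w 1'       = refl

  eval-subst : ∀ {a b} {X : Set a} {Y : Set b} (w : Y → Carrier) (σ : X → Term Y) t →
               eval B w (eval (Free Y) σ t) ≡ eval B (λ x → eval B w (σ x)) t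
  eval-subst w σ (var x)  = ≡.refl
  eval-subst w σ (t ∧' u) = ≡.cong₂ _∧_ (eval-subst w σ t) (eval-subst w σ u)
  eval-subst w σ (t ∨' u) = ≡.cong₂ _∨_ (eval-subst w σ t) (eval-subst w σ u)
  eval-subst w σ (¬' t)   = ≡.cong ¬_ (eval-subst w σ t)
  eval-subst w σ 0'       = ≡.refl
  eval-subst w σ 1'       = ≡.refl

  evalʰ : ∀ {a} {X : Set a} → (X → Carrier) → Hom (Free X) B
  evalʰ v = record
    { ⟦_⟧ = eval B v ; cong = eval-cong v
    ; hom-∧ = λ _ _ → refl ; hom-∨ = λ _ _ → refl ; hom-¬ = λ _ → refl
    ; hom-0 = refl ; hom-1 = refl }

eval-var : ∀ {a} {X : Set a} (t : Term X) → eval (Free X) var t ~ t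
eval-var (var x)  = ~refl
eval-var (t ∧' u) = ∧-cg (eval-var t) (eval-var u)
eval-var (t ∨' u) = ∨-cg (eval-var t) (eval-var u)
eval-var (¬' t)   = ¬-cg (eval-var t)
eval-var 0'       = ~refl
eval-var 1'       = ~refl

module _ {c₁ ℓ₁ c₂ ℓ₂} {A : KleeneAlgebra c₁ ℓ₁} {B : KleeneAlgebra c₂ ℓ₂} where
  private
    module A = KleeneProperties A
    module B = KleeneProperties B

  hom-eval : (H : Hom A B) → ∀ {a} {X : Set a} (v : X → A.Carrier) t →
             Hom.⟦ H ⟧ (eval A v t) B.≈ eval B (λ x → Hom.⟦ H ⟧ (v x)) t
  hom-eval H v (var x)  = B.refl
  hom-eval H v (t ∧' u) = B.trans (Hom.hom-∧ H _ _) (B.∧-cong (hom-eval H v t) (hom-eval H v u))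
  hom-eval H v (t ∨' u) = B.trans (Hom.hom-∨ H _ _) (B.∨-cong (hom-eval H v t) (hom-eval H v u))
  hom-eval H v (¬' t)   = B.trans (Hom.hom-¬ H _) (B.¬-cong (hom-eval H v t))
  hom-eval H v 0'       = Hom.hom-0 H
  hom-eval H v 1'       = Hom.hom-1 H

  mkHom : (f : A.Carrier → B.Carrier) → (∀ {x y} → x A.≈ y → f x B.≈ f y) →
          (∀ x y → f (x A.∧ y) B.≈ f x B.∧ f y) → (∀ x → f (A.¬ x) B.≈ B.¬ f x) →
          f A.0# B.≈ B.0# → Hom A B
  mkHom f f-cong f-∧ f-¬ f-0 = record
    { ⟦_⟧ = f ; cong = f-cong ; hom-∧ = f-∧ ; hom-¬ = f-¬ ; hom-0 = f-0
    ; hom-∨ = λ x y → begin-equality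
        f (x A.∨ y)                  ≈⟨ f-cong (A.∨-via-∧ x y) ⟩
        f (A.¬ (A.¬ x A.∧ A.¬ y))    ≈⟨ f-¬ _ ⟩
        B.¬ f (A.¬ x A.∧ A.¬ y)      ≈⟨ B.¬-cong (B.trans (f-∧ _ _) (B.∧-cong (f-¬ x) (f-¬ y))) ⟩
        B.¬ (B.¬ f x B.∧ B.¬ f y)    ≈⟨ B.∨-via-∧ (f x) (f y) ⟨
        f x B.∨ f y                  ∎
    ; hom-1 = begin-equality
        f A.1#          ≈⟨ f-cong (A.sym A.¬0≈1) ⟩
        f (A.¬ A.0#)    ≈⟨ f-¬ A.0# ⟩
        B.¬ f A.0#      ≈⟨ B.¬-cong f-0 ⟩
        B.¬ B.0#        ≈⟨ B.¬0≈1 ⟩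
        B.1#            ∎ }
    where open B using (begin-equality_; step-≈-⟩; step-≈-⟨; _∎)

idʰ : ∀ {c ℓ} (B : KleeneAlgebra c ℓ) → Hom B B
idʰ B = record
  { ⟦_⟧ = λ x → x ; cong = λ x≈y → x≈y
  ; hom-∧ = λ _ _ → refl ; hom-∨ = λ _ _ → refl ; hom-¬ = λ _ → refl ; hom-0 = refl ; hom-1 = refl }
  where open KleeneProperties B using (refl)

infixr 9 _∘ʰ_
_∘ʰ_ : ∀ {c₁ ℓ₁ c₂ ℓ₂ c₃ ℓ₃} {A : KleeneAlgebra c₁ ℓ₁} {B : KleeneAlgebra c₂ ℓ₂} {C : KleeneAlgebra c₃ ℓ₃} →
       Hom B C → Hom A B → Hom A C
_∘ʰ_ {C = C} G F = record
  { ⟦_⟧ = λ x → G.⟦ F.⟦ x ⟧ ⟧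
  ; cong  = λ x≈y → G.cong (F.cong x≈y)
  ; hom-∧ = λ x y → trans (G.cong (F.hom-∧ x y)) (G.hom-∧ _ _)
  ; hom-∨ = λ x y → trans (G.cong (F.hom-∨ x y)) (G.hom-∨ _ _)
  ; hom-¬ = λ x → trans (G.cong (F.hom-¬ x)) (G.hom-¬ _)
  ; hom-0 = trans (G.cong F.hom-0) G.hom-0
  ; hom-1 = trans (G.cong F.hom-1) G.hom-1 }
  where
  module G = Hom G
  module F = Hom F
  open KleeneProperties C using (trans)

module Inclusions {c ℓ} (B : KleeneAlgebra c ℓ) where
  open KleeneProperties B

  ι𝟚 : Hom 𝟚KA B
  ι𝟚 = mkHom ι (λ { ≡.refl → refl }) ι-∧ ι-¬ refl
    where
    ι : 𝟚KA-El → Carrier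
    ι t0 = 0#
    ι t1 = 1#

    ι-∧ : ∀ i j → ι (𝟚KA-∧ i j) ≈ ι i ∧ ι j
    ι-∧ t0 t0 = 0≤ 0#
    ι-∧ t0 t1 = 0≤ 1#
    ι-∧ t1 t0 = ≥⇒≈∧ (0≤ 1#)
    ι-∧ t1 t1 = ≤1 1#

    ι-¬ : ∀ i → ι (𝟚KA-¬ i) ≈ ¬ ι i
    ι-¬ t0 = sym ¬0≈1
    ι-¬ t1 = sym ¬1≈0

  ι₄ : (e : Carrier) → Small e → Hom K₄ B
  ι₄ e e≤¬e = mkHom ι (λ { ≡.refl → refl }) ι-∧ ι-¬ refl
    where
    ι : K₄-El → Carrier
    ι k0 = 0#
    ι kb = e
    ι ka = ¬ e
    ι k1 = 1#

    ι-∧ : ∀ i j → ι (K₄-∧ i j) ≈ ι i ∧ ι j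
    ι-∧ k0 k0 = 0≤ 0#
    ι-∧ k0 kb = 0≤ e
    ι-∧ k0 ka = 0≤ (¬ e)
    ι-∧ k0 k1 = 0≤ 1#
    ι-∧ kb k0 = ≥⇒≈∧ (0≤ e)
    ι-∧ kb kb = ≤-refl
    ι-∧ kb ka = e≤¬e
    ι-∧ kb k1 = ≤1 e
    ι-∧ ka k0 = ≥⇒≈∧ (0≤ (¬ e))
    ι-∧ ka kb = ≥⇒≈∧ e≤¬e
    ι-∧ ka ka = ≤-refl
    ι-∧ ka k1 = ≤1 (¬ e)
    ι-∧ k1 k0 = ≥⇒≈∧ (0≤ 1#)
    ι-∧ k1 kb = ≥⇒≈∧ (≤1 e)
    ι-∧ k1 ka = ≥⇒≈∧ (≤1 (¬ e))
    ι-∧ k1 k1 = ≤-refl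

    ι-¬ : ∀ i → ι (K₄-¬ i) ≈ ¬ ι i
    ι-¬ k0 = sym ¬0≈1
    ι-¬ kb = refl
    ι-¬ ka = sym (¬-involutive e)
    ι-¬ k1 = sym ¬1≈0

module _ {c₁ ℓ₁ c₂ ℓ₂} {A : KleeneAlgebra c₁ ℓ₁} {B : KleeneAlgebra c₂ ℓ₂} where
  private
    module A = KleeneProperties A
    module B = KleeneProperties B

  hom-small : (H : Hom A B) → ∀ {x} → A.Small x → B.Small (Hom.⟦ H ⟧ x)
  hom-small H {x} x≤¬x = B.trans (Hom.cong H x≤¬x)
                                 (B.trans (Hom.hom-∧ H x (A.¬ x)) (B.∧-congˡ (Hom.hom-¬ H x)))

  embedding-reflects-small : ((H , H-injective) : Embedding A B) → ∀ {x} → B.Small (Hom.⟦ H ⟧ x) → A.Small x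
  embedding-reflects-small (H , H-injective) {x} Hx≤¬Hx = H-injective x (x A.∧ A.¬ x)
    (B.trans Hx≤¬Hx (B.sym (B.trans (Hom.hom-∧ H x (A.¬ x)) (B.∧-congˡ (Hom.hom-¬ H x)))))

  hom-ι𝟚 : (H : Hom A B) → ∀ b → Hom.⟦ H ⟧ (Hom.⟦ Inclusions.ι𝟚 A ⟧ b) B.≈ Hom.⟦ Inclusions.ι𝟚 B ⟧ b
  hom-ι𝟚 H t0 = Hom.hom-0 H
  hom-ι𝟚 H t1 = Hom.hom-1 H

  retract⇒embedding : Retract A B → Embedding A B
  retract⇒embedding (s , r , r∘s) = s , λ x y sx≈sy →
    A.trans (A.sym (r∘s x)) (A.trans (Hom.cong r sx≈sy) (r∘s y))

Unsatisfiable : ∀ {n} → Term (Fin n) → Set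
Unsatisfiable {n} t = ∀ (b : Fin n → 𝟚KA-El) → eval 𝟚KA b t ≡ t0

_[_/0] : ∀ {n} → Term (Fin (suc n)) → Term (Fin n) → Term (Fin n)
t [ e /0] = eval (Free _) (e ∷ var) t

unsatisfiable-[/0] : ∀ {n} (t : Term (Fin (suc n))) e → Unsatisfiable t → Unsatisfiable (t [ e /0])
unsatisfiable-[/0] t e unsat b = ≡.trans (Evaluation.eval-subst 𝟚KA b (e ∷ var) t) (unsat _)

Satisfiable : ∀ {n} → Term (Fin n) → Set
Satisfiable {n} t = Σ (Fin n → 𝟚KA-El) λ b → eval 𝟚KA b t ≡ t1

¬satisfiable⇒unsatisfiable : ∀ {n} (t : Term (Fin n)) → (Satisfiable t → ⊥) → Unsatisfiable t
¬satisfiable⇒unsatisfiable t unsat b with eval 𝟚KA b t in e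
... | t0 = ≡.refl
... | t1 = ⊥-elim (unsat (b , e))

_≟𝟚_ : DecidableEquality 𝟚KA-El
t0 ≟𝟚 t0 = yes ≡.refl
t0 ≟𝟚 t1 = no λ ()
t1 ≟𝟚 t0 = no λ ()
t1 ≟𝟚 t1 = yes ≡.refl

fromBool : Bool → 𝟚KA-El
fromBool false = t0
fromBool true  = t1

toBool : 𝟚KA-El → Bool
toBool t0 = false
toBool t1 = true

fromBool∘toBool : ∀ b → fromBool (toBool b) ≡ b
fromBool∘toBool t0 = ≡.refl
fromBool∘toBool t1 = ≡.refl

-- Boolean valuations are enumerated as subsets, whose existential quantifier the library decides.
satisfiable? : ∀ {n} (t : Term (Fin n)) → Dec (Satisfiable t)
satisfiable? {n} t = map′ (λ (s , e) → valuation s , e)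
                          (λ (b , e) → subset b , ≡.trans (Evaluation.eval-≗ 𝟚KA (valuation∘subset b) t) e)
                          (anySubset? (λ s → eval 𝟚KA (valuation s) t ≟𝟚 t1))
  where
  valuation : Subset n → Fin n → 𝟚KA-El
  valuation s i = fromBool (lookup s i)
  subset : (Fin n → 𝟚KA-El) → Subset n
  subset b = tabulate (λ i → toBool (b i))
  valuation∘subset : ∀ b i → valuation (subset b) i ≡ b i
  valuation∘subset b i = ≡.trans (≡.cong fromBool (lookup∘tabulate _ i)) (fromBool∘toBool (b i))

module KleeneShannon {c ℓ} (B : KleeneAlgebra c ℓ) where
  open KleeneProperties B
  open Evaluation B
  open Inclusions B

  module _ {n} (v : Fin (suc n) → Carrier) where
    private
      ⟦_⟧ ⟦_⟧₀ ⟦_⟧₁ : Term (Fin (suc n)) → Carrier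
      ⟦ t ⟧  = eval B v t
      ⟦ t ⟧₀ = eval B (0# ∷ tail v) t
      ⟦ t ⟧₁ = eval B (1# ∷ tail v) t
      x = v zero

    shannon-expansion : ∀ t → ⟦ t ⟧ ≤ shannon x ⟦ t ⟧₀ ⟦ t ⟧₁
                            × ¬ ⟦ t ⟧ ≤ shannon x (¬ ⟦ t ⟧₀) (¬ ⟦ t ⟧₁)
    shannon-expansion (var zero) =
      ∧-greatest (x≤x∨y x 0#) (≤-trans (≤1 x) (y≤x∨y (¬ x) 1#)) ,
      ∧-greatest (≤-trans (≤1 (¬ x)) (≤-trans (≈⇒≤ (sym ¬0≈1)) (y≤x∨y x (¬ 0#)))) (x≤x∨y (¬ x) (¬ 1#))
    shannon-expansion (var (suc i)) =
      ≤-shannon-diagonal x (v (suc i)) , ≤-shannon-diagonal x (¬ v (suc i))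
    shannon-expansion (t ∧' u) with shannon-expansion t | shannon-expansion u
    ... | t≤ , ¬t≤ | u≤ , ¬u≤ =
      ≤-trans (∧-monotonic t≤ u≤) (≈⇒≤ (shannon-∧ x _ _ _ _)) ,
      (begin
        ¬ (⟦ t ⟧ ∧ ⟦ u ⟧)                                            ≈⟨ ¬-distrib-∧ _ _ ⟩
        ¬ ⟦ t ⟧ ∨ ¬ ⟦ u ⟧                                            ≤⟨ ∨-monotonic ¬t≤ ¬u≤ ⟩
        shannon x (¬ ⟦ t ⟧₀) (¬ ⟦ t ⟧₁) ∨ shannon x (¬ ⟦ u ⟧₀) (¬ ⟦ u ⟧₁) ≤⟨ shannon-∨ x _ _ _ _ ⟩
        shannon x (¬ ⟦ t ⟧₀ ∨ ¬ ⟦ u ⟧₀) (¬ ⟦ t ⟧₁ ∨ ¬ ⟦ u ⟧₁)          ≈⟨ shannon-cong (¬-distrib-∧ _ _) (¬-distrib-∧ _ _) ⟨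
        shannon x (¬ (⟦ t ⟧₀ ∧ ⟦ u ⟧₀)) (¬ (⟦ t ⟧₁ ∧ ⟦ u ⟧₁))        ∎)
    shannon-expansion (t ∨' u) with shannon-expansion t | shannon-expansion u
    ... | t≤ , ¬t≤ | u≤ , ¬u≤ =
      ≤-trans (∨-monotonic t≤ u≤) (shannon-∨ x _ _ _ _) ,
      (begin
        ¬ (⟦ t ⟧ ∨ ⟦ u ⟧)                                            ≈⟨ ¬-distrib-∨ _ _ ⟩
        ¬ ⟦ t ⟧ ∧ ¬ ⟦ u ⟧                                            ≤⟨ ∧-monotonic ¬t≤ ¬u≤ ⟩
        shannon x (¬ ⟦ t ⟧₀) (¬ ⟦ t ⟧₁) ∧ shannon x (¬ ⟦ u ⟧₀) (¬ ⟦ u ⟧₁) ≈⟨ shannon-∧ x _ _ _ _ ⟩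
        shannon x (¬ ⟦ t ⟧₀ ∧ ¬ ⟦ u ⟧₀) (¬ ⟦ t ⟧₁ ∧ ¬ ⟦ u ⟧₁)          ≈⟨ shannon-cong (¬-distrib-∨ _ _) (¬-distrib-∨ _ _) ⟨
        shannon x (¬ (⟦ t ⟧₀ ∨ ⟦ u ⟧₀)) (¬ (⟦ t ⟧₁ ∨ ⟦ u ⟧₁))        ∎)
    shannon-expansion (¬' t) with shannon-expansion t
    ... | t≤ , ¬t≤ =
      ¬t≤ ,
      ≤-trans (≈⇒≤ (¬-involutive _))
        (≤-trans t≤ (≈⇒≤ (shannon-cong (sym (¬-involutive _)) (sym (¬-involutive _)))))
    shannon-expansion 0' = 0≤ _ , ≤-shannon-diagonal x (¬ 0#)
    shannon-expansion 1' = ≤-shannon-diagonal x 1# , ≤-trans (≈⇒≤ ¬1≈0) (0≤ _)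

  unsatisfiable⇒small : ∀ {n} (t : Term (Fin n)) → Unsatisfiable t → ∀ v → Small (eval B v t)
  unsatisfiable⇒small {zero} t unsat v = small-resp-≈ (sym closed≈0) (0≤ (¬ 0#))
    where
    closed≈0 : eval B v t ≈ 0#
    closed≈0 = begin-equality
      eval B v t                                  ≈⟨ eval-≗ (λ ()) t ⟩
      eval B (λ i → Hom.⟦ ι𝟚 ⟧ (v′ i)) t          ≈⟨ hom-eval ι𝟚 v′ t ⟨
      Hom.⟦ ι𝟚 ⟧ (eval 𝟚KA v′ t)                  ≡⟨ ≡.cong Hom.⟦ ι𝟚 ⟧ (unsat v′) ⟩
      0#                                          ∎
      where
      v′ : Fin zero → 𝟚KA-El
      v′ ()
  unsatisfiable⇒small {suc n} t unsat v =
    small-downward (proj₁ (shannon-expansion v t))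
                   (small-shannon (v zero) (small-at 0') (small-at 1'))
    where
    small-at : ∀ e → Small (eval B (eval B (tail v) e ∷ tail v) t)
    small-at e = small-resp-≈ (trans (reflexive (eval-subst (tail v) (e ∷ var) t))
                                     (eval-≗ (λ { zero → refl ; (suc i) → refl }) t))
                   (unsatisfiable⇒small (t [ e /0]) (unsatisfiable-[/0] t e unsat) (tail v))

module Pinning {c ℓ} (B : KleeneAlgebra c ℓ) where
  open KleeneProperties B
  private
    module K₄ = KleeneProperties K₄

  data Pinned (b : Carrier) : K₄-El → Set ℓ where
    pinned-0 : b ≈ 0# → Pinned b k0
    pinned-1 : b ≈ 1# → Pinned b k1
    pinned-b : Pinned b kb
    pinned-a : Pinned b ka

  pinned-resp : ∀ {b b′ k} → b ≈ b′ → Pinned b k → Pinned b′ k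
  pinned-resp b≈b′ (pinned-0 b≈0) = pinned-0 (trans (sym b≈b′) b≈0)
  pinned-resp b≈b′ (pinned-1 b≈1) = pinned-1 (trans (sym b≈b′) b≈1)
  pinned-resp b≈b′ pinned-b = pinned-b
  pinned-resp b≈b′ pinned-a = pinned-a

  pinned-∧ : ∀ {b b′ k k′} → Pinned b k → Pinned b′ k′ → Pinned (b ∧ b′) (K₄-∧ k k′)
  pinned-∧ {b} {b′} = go
    where
    left : b ≈ 0# → b ∧ b′ ≈ 0#
    left b≈0 = trans (∧-congʳ b≈0) (sym (0≤ b′))
    right : b′ ≈ 0# → b ∧ b′ ≈ 0#
    right b′≈0 = trans (∧-congˡ b′≈0) (trans (∧-comm b 0#) (sym (0≤ b)))
    go : ∀ {k k′} → Pinned b k → Pinned b′ k′ → Pinned (b ∧ b′) (K₄-∧ k k′)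
    go (pinned-0 b≈0) (pinned-0 _)    = pinned-0 (left b≈0)
    go (pinned-0 b≈0) (pinned-1 _)    = pinned-0 (left b≈0)
    go (pinned-0 b≈0) pinned-b        = pinned-0 (left b≈0)
    go (pinned-0 b≈0) pinned-a        = pinned-0 (left b≈0)
    go (pinned-1 _)   (pinned-0 b′≈0) = pinned-0 (right b′≈0)
    go pinned-b       (pinned-0 b′≈0) = pinned-0 (right b′≈0)
    go pinned-a       (pinned-0 b′≈0) = pinned-0 (right b′≈0)
    go (pinned-1 b≈1) (pinned-1 b′≈1) = pinned-1 (trans (∧-cong b≈1 b′≈1) (∧-identityʳ 1#))
    go (pinned-1 _)   pinned-b        = pinned-b
    go (pinned-1 _)   pinned-a        = pinned-a
    go pinned-b       (pinned-1 _)    = pinned-b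
    go pinned-a       (pinned-1 _)    = pinned-a
    go pinned-b       pinned-b        = pinned-b
    go pinned-b       pinned-a        = pinned-b
    go pinned-a       pinned-b        = pinned-b
    go pinned-a       pinned-a        = pinned-a

  pinned-¬ : ∀ {b k} → Pinned b k → Pinned (¬ b) (K₄-¬ k)
  pinned-¬ (pinned-0 b≈0) = pinned-1 (trans (¬-cong b≈0) ¬0≈1)
  pinned-¬ (pinned-1 b≈1) = pinned-0 (trans (¬-cong b≈1) ¬1≈0)
  pinned-¬ pinned-b       = pinned-a
  pinned-¬ pinned-a       = pinned-b

  pinned-∨ : ∀ {b b′ k k′} → Pinned b k → Pinned b′ k′ → Pinned (b ∨ b′) (K₄-∨ k k′)
  pinned-∨ {k = k} {k′} p p′ =
    ≡.subst (Pinned _) (≡.sym (K₄.∨-via-∧ k k′))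
      (pinned-resp (sym (∨-via-∧ _ _)) (pinned-¬ (pinned-∧ (pinned-¬ p) (pinned-¬ p′))))

  -- Evaluating at the all-ka point of K₄ detects the terms that are constantly 0 or 1.
  pinned-eval : ∀ {a} {X : Set a} (v : X → Carrier) t → Pinned (eval B v t) (eval K₄ (λ _ → ka) t)
  pinned-eval v (var x)  = pinned-a
  pinned-eval v (t ∧' u) = pinned-∧ (pinned-eval v t) (pinned-eval v u)
  pinned-eval v (t ∨' u) = pinned-∨ (pinned-eval v t) (pinned-eval v u)
  pinned-eval v (¬' t)   = pinned-¬ (pinned-eval v t)
  pinned-eval v 0'       = pinned-0 refl
  pinned-eval v 1'       = pinned-1 refl

-- The six elements 0 < z ∧ ¬ z < z , ¬ z < z ∨ ¬ z < 1 of the free Kleene algebra on z.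
data NF : Set where
  #0 #z∧¬z #z #¬z #z∨¬z #1 : NF

infixr 7 _∧ⁿ_
infixr 6 _∨ⁿ_

¬ⁿ_ : NF → NF
¬ⁿ #0     = #1
¬ⁿ #z∧¬z  = #z∨¬z
¬ⁿ #z     = #¬z
¬ⁿ #¬z    = #z
¬ⁿ #z∨¬z  = #z∧¬z
¬ⁿ #1     = #0

_∧ⁿ_ : NF → NF → NF
#0    ∧ⁿ _      = #0
#1    ∧ⁿ j      = j
#z∧¬z ∧ⁿ #0     = #0
#z∧¬z ∧ⁿ _      = #z∧¬z
#z    ∧ⁿ #0     = #0
#z    ∧ⁿ #z∧¬z  = #z∧¬z
#z    ∧ⁿ #z     = #z
#z    ∧ⁿ #¬z    = #z∧¬z
#z    ∧ⁿ #z∨¬z  = #z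
#z    ∧ⁿ #1     = #z
#¬z   ∧ⁿ #0     = #0
#¬z   ∧ⁿ #z∧¬z  = #z∧¬z
#¬z   ∧ⁿ #z     = #z∧¬z
#¬z   ∧ⁿ #¬z    = #¬z
#¬z   ∧ⁿ #z∨¬z  = #¬z
#¬z   ∧ⁿ #1     = #¬z
#z∨¬z ∧ⁿ #1     = #z∨¬z
#z∨¬z ∧ⁿ j      = j

_∨ⁿ_ : NF → NF → NF
i ∨ⁿ j = ¬ⁿ (¬ⁿ i ∧ⁿ ¬ⁿ j)

normalForm : ∀ {a} {X : Set a} → Term X → NF
normalForm (var _)  = #z
normalForm (t ∧' u) = normalForm t ∧ⁿ normalForm u
normalForm (t ∨' u) = normalForm t ∨ⁿ normalForm u
normalForm (¬' t)   = ¬ⁿ normalForm t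
normalForm 0'       = #0
normalForm 1'       = #1

module NormalForm {c ℓ} (B : KleeneAlgebra c ℓ) (z : KleeneAlgebra.Carrier B) where
  open KleeneProperties B

  ⟦_⟧ⁿ : NF → Carrier
  ⟦ #0 ⟧ⁿ    = 0#
  ⟦ #z∧¬z ⟧ⁿ = z ∧ ¬ z
  ⟦ #z ⟧ⁿ    = z
  ⟦ #¬z ⟧ⁿ   = ¬ z
  ⟦ #z∨¬z ⟧ⁿ = z ∨ ¬ z
  ⟦ #1 ⟧ⁿ    = 1#

  ⟦⟧ⁿ-¬ : ∀ i → ⟦ ¬ⁿ i ⟧ⁿ ≈ ¬ ⟦ i ⟧ⁿ
  ⟦⟧ⁿ-¬ #0    = sym ¬0≈1
  ⟦⟧ⁿ-¬ #z∧¬z = sym (trans (¬-distrib-∧ z (¬ z)) (trans (∨-congˡ (¬-involutive z)) (∨-comm (¬ z) z)))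
  ⟦⟧ⁿ-¬ #z    = refl
  ⟦⟧ⁿ-¬ #¬z   = sym (¬-involutive z)
  ⟦⟧ⁿ-¬ #z∨¬z = sym (trans (¬-distrib-∨ z (¬ z)) (trans (∧-congˡ (¬-involutive z)) (∧-comm (¬ z) z)))
  ⟦⟧ⁿ-¬ #1    = sym ¬1≈0

  private
    m≤z : z ∧ ¬ z ≤ z
    m≤z = x∧y≤x z (¬ z)
    m≤¬z : z ∧ ¬ z ≤ ¬ z
    m≤¬z = x∧y≤y z (¬ z)
    z≤j : z ≤ z ∨ ¬ z
    z≤j = x≤x∨y z (¬ z)
    ¬z≤j : ¬ z ≤ z ∨ ¬ z
    ¬z≤j = y≤x∨y z (¬ z)

  -- Apart from z ∧ ¬ z, every clause compares i and j, so it is an inequality (or its mirror image).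
  ⟦⟧ⁿ-∧ : ∀ i j → ⟦ i ∧ⁿ j ⟧ⁿ ≈ ⟦ i ⟧ⁿ ∧ ⟦ j ⟧ⁿ
  ⟦⟧ⁿ-∧ #0    j      = 0≤ ⟦ j ⟧ⁿ
  ⟦⟧ⁿ-∧ #1    j      = ≥⇒≈∧ (≤1 ⟦ j ⟧ⁿ)
  ⟦⟧ⁿ-∧ #z∧¬z #0     = ≥⇒≈∧ (0≤ _)
  ⟦⟧ⁿ-∧ #z∧¬z #z∧¬z  = ≤-refl
  ⟦⟧ⁿ-∧ #z∧¬z #z     = m≤z
  ⟦⟧ⁿ-∧ #z∧¬z #¬z    = m≤¬z
  ⟦⟧ⁿ-∧ #z∧¬z #z∨¬z  = ≤-trans m≤z z≤j
  ⟦⟧ⁿ-∧ #z∧¬z #1     = ≤1 _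
  ⟦⟧ⁿ-∧ #z    #0     = ≥⇒≈∧ (0≤ z)
  ⟦⟧ⁿ-∧ #z    #z∧¬z  = ≥⇒≈∧ m≤z
  ⟦⟧ⁿ-∧ #z    #z     = ≤-refl
  ⟦⟧ⁿ-∧ #z    #¬z    = refl
  ⟦⟧ⁿ-∧ #z    #z∨¬z  = z≤j
  ⟦⟧ⁿ-∧ #z    #1     = ≤1 z
  ⟦⟧ⁿ-∧ #¬z   #0     = ≥⇒≈∧ (0≤ (¬ z))
  ⟦⟧ⁿ-∧ #¬z   #z∧¬z  = ≥⇒≈∧ m≤¬z
  ⟦⟧ⁿ-∧ #¬z   #z     = ∧-comm z (¬ z)
  ⟦⟧ⁿ-∧ #¬z   #¬z    = ≤-refl
  ⟦⟧ⁿ-∧ #¬z   #z∨¬z  = ¬z≤j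
  ⟦⟧ⁿ-∧ #¬z   #1     = ≤1 (¬ z)
  ⟦⟧ⁿ-∧ #z∨¬z #0     = ≥⇒≈∧ (0≤ _)
  ⟦⟧ⁿ-∧ #z∨¬z #z∧¬z  = ≥⇒≈∧ (≤-trans m≤z z≤j)
  ⟦⟧ⁿ-∧ #z∨¬z #z     = ≥⇒≈∧ z≤j
  ⟦⟧ⁿ-∧ #z∨¬z #¬z    = ≥⇒≈∧ ¬z≤j
  ⟦⟧ⁿ-∧ #z∨¬z #z∨¬z  = ≤-refl
  ⟦⟧ⁿ-∧ #z∨¬z #1     = ≤1 _

  ⟦⟧ⁿ-∨ : ∀ i j → ⟦ i ∨ⁿ j ⟧ⁿ ≈ ⟦ i ⟧ⁿ ∨ ⟦ j ⟧ⁿ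
  ⟦⟧ⁿ-∨ i j = begin-equality
    ⟦ ¬ⁿ (¬ⁿ i ∧ⁿ ¬ⁿ j) ⟧ⁿ        ≈⟨ ⟦⟧ⁿ-¬ (¬ⁿ i ∧ⁿ ¬ⁿ j) ⟩
    ¬ ⟦ ¬ⁿ i ∧ⁿ ¬ⁿ j ⟧ⁿ           ≈⟨ ¬-cong (trans (⟦⟧ⁿ-∧ (¬ⁿ i) (¬ⁿ j)) (∧-cong (⟦⟧ⁿ-¬ i) (⟦⟧ⁿ-¬ j))) ⟩
    ¬ (¬ ⟦ i ⟧ⁿ ∧ ¬ ⟦ j ⟧ⁿ)       ≈⟨ ∨-via-∧ ⟦ i ⟧ⁿ ⟦ j ⟧ⁿ ⟨
    ⟦ i ⟧ⁿ ∨ ⟦ j ⟧ⁿ               ∎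

  eval≈⟦normalForm⟧ : ∀ {a} {X : Set a} (t : Term X) → eval B (λ _ → z) t ≈ ⟦ normalForm t ⟧ⁿ
  eval≈⟦normalForm⟧ (var _)  = refl
  eval≈⟦normalForm⟧ (t ∧' u) = trans (∧-cong (eval≈⟦normalForm⟧ t) (eval≈⟦normalForm⟧ u)) (sym (⟦⟧ⁿ-∧ (normalForm t) (normalForm u)))
  eval≈⟦normalForm⟧ (t ∨' u) = trans (∨-cong (eval≈⟦normalForm⟧ t) (eval≈⟦normalForm⟧ u)) (sym (⟦⟧ⁿ-∨ (normalForm t) (normalForm u)))
  eval≈⟦normalForm⟧ (¬' t)   = trans (¬-cong (eval≈⟦normalForm⟧ t)) (sym (⟦⟧ⁿ-¬ (normalForm t)))
  eval≈⟦normalForm⟧ 0'       = refl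
  eval≈⟦normalForm⟧ 1'       = refl

eval-generator : (t : Term (Fin 1)) → eval F₁ (λ _ → var zero) t ~ t
eval-generator t = ~trans (Evaluation.eval-≗ F₁ (λ { zero → ~refl }) t) (eval-var t)

data Middle : K₄-El → Set where
  middle-a : Middle ka
  middle-b : Middle kb

profile : K₄-El → Term (Fin 1) → 𝟚KA-El × K₄-El × 𝟚KA-El
profile k t = eval 𝟚KA (λ _ → t0) t , eval K₄ (λ _ → k) t , eval 𝟚KA (λ _ → t1) t

-- The values at z = 0 and z = 1 leave only #0/#z∧¬z and #z∨¬z/#1 undistinguished;
-- a value at a middle point of K₄ separates those.
decode : 𝟚KA-El × K₄-El × 𝟚KA-El → NF
decode (t0 , k0 , t0) = #0
decode (t0 , _  , t0) = #z∧¬z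
decode (t0 , _  , t1) = #z
decode (t1 , _  , t0) = #¬z
decode (t1 , k1 , t1) = #1
decode (t1 , _  , t1) = #z∨¬z

decode-profile : ∀ {k} → Middle k → ∀ t → decode (profile k t) ≡ normalForm t
decode-profile {k} middle t = ≡.trans
  (≡.cong decode (≡.cong₂ _,_ (N𝟚.eval≈⟦normalForm⟧ t0 t)
                  (≡.cong₂ _,_ (NormalForm.eval≈⟦normalForm⟧ K₄ k t) (N𝟚.eval≈⟦normalForm⟧ t1 t))))
  (decode-⟦⟧ⁿ middle (normalForm t))
  where
  module N𝟚 = NormalForm 𝟚KA
  decode-⟦⟧ⁿ : ∀ {k} → Middle k → ∀ i →
               decode (N𝟚.⟦_⟧ⁿ t0 i , NormalForm.⟦_⟧ⁿ K₄ k i , N𝟚.⟦_⟧ⁿ t1 i) ≡ i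
  decode-⟦⟧ⁿ middle-a #0    = ≡.refl
  decode-⟦⟧ⁿ middle-a #z∧¬z = ≡.refl
  decode-⟦⟧ⁿ middle-a #z    = ≡.refl
  decode-⟦⟧ⁿ middle-a #¬z   = ≡.refl
  decode-⟦⟧ⁿ middle-a #z∨¬z = ≡.refl
  decode-⟦⟧ⁿ middle-a #1    = ≡.refl
  decode-⟦⟧ⁿ middle-b #0    = ≡.refl
  decode-⟦⟧ⁿ middle-b #z∧¬z = ≡.refl
  decode-⟦⟧ⁿ middle-b #z    = ≡.refl
  decode-⟦⟧ⁿ middle-b #¬z   = ≡.refl
  decode-⟦⟧ⁿ middle-b #z∨¬z = ≡.refl
  decode-⟦⟧ⁿ middle-b #1    = ≡.refl

F₁-separated : ∀ {k} → Middle k → ∀ t u → profile k t ≡ profile k u → t ~ u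
F₁-separated middle t u same = ~trans (~normalForm t)
  (~trans (reflexive (≡.cong ⟦_⟧ⁿ (≡.trans (≡.sym (decode-profile middle t))
                                  (≡.trans (≡.cong decode same) (decode-profile middle u)))))
          (~sym (~normalForm u)))
  where
  open KleeneProperties F₁ using (reflexive)
  open NormalForm F₁ (var zero)
  ~normalForm : ∀ t → t ~ ⟦ normalForm t ⟧ⁿ
  ~normalForm t = ~trans (~sym (eval-generator t)) (eval≈⟦normalForm⟧ t)

module _ {c₁ ℓ₁ c₂ ℓ₂} (A : KleeneAlgebra c₁ ℓ₁) (T : KleeneAlgebra c₂ ℓ₂) where
  private
    module A = KleeneProperties A
    module T = KleeneProperties T

  Reflects : A.Carrier → T.Carrier → Set (ℓ₁ ⊔ ℓ₂)
  Reflects a τ = ∀ (t u : Term (Fin 1)) → eval A (λ _ → a) t A.≈ eval A (λ _ → a) u →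
                         eval T (λ _ → τ) t T.≈ eval T (λ _ → τ) u

  hom⇒reflects : (H : Hom A T) → ∀ {a τ} → Hom.⟦ H ⟧ a T.≈ τ → Reflects a τ
  hom⇒reflects H {a} {τ} Ha≈τ t u ea≈eu = begin-equality
    eval T (λ _ → τ) t                   ≈⟨ Evaluation.eval-≗ T (λ _ → T.sym Ha≈τ) t ⟩
    eval T (λ _ → Hom.⟦ H ⟧ a) t         ≈⟨ hom-eval H (λ _ → a) t ⟨
    Hom.⟦ H ⟧ (eval A (λ _ → a) t)       ≈⟨ Hom.cong H ea≈eu ⟩
    Hom.⟦ H ⟧ (eval A (λ _ → a) u)       ≈⟨ hom-eval H (λ _ → a) u ⟩
    eval T (λ _ → Hom.⟦ H ⟧ a) u         ≈⟨ Evaluation.eval-≗ T (λ _ → Ha≈τ) u ⟩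
    eval T (λ _ → τ) u                   ∎
    where open T

  ≅-fromGenerators : ∀ {a τ} → GeneratedBy A {1} (λ _ → a) → GeneratedBy T {1} (λ _ → τ) →
                     (G : Hom T A) → Hom.⟦ G ⟧ τ A.≈ a → Reflects a τ → A ≅ T
  ≅-fromGenerators {a} {τ} generatedA generatedT G Gτ≈a reflects = F , G , G∘F , F∘G
    where
    term : A.Carrier → Term (Fin 1)
    term x = proj₁ (generatedA x)

    ⟦_⟧ₐ : Term (Fin 1) → A.Carrier
    ⟦ t ⟧ₐ = eval A (λ _ → a) t

    ⟦_⟧τ : Term (Fin 1) → T.Carrier
    ⟦ t ⟧τ = eval T (λ _ → τ) t

    f : A.Carrier → T.Carrier
    f x = ⟦ term x ⟧τ

    f-spec : ∀ {x} t → ⟦ t ⟧ₐ A.≈ x → f x T.≈ ⟦ t ⟧τ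
    f-spec {x} t t≈x = reflects (term x) t (A.trans (proj₂ (generatedA x)) (A.sym t≈x))

    F : Hom A T
    F = mkHom f (λ {x} {y} x≈y → f-spec (term y) (A.trans (proj₂ (generatedA y)) (A.sym x≈y)))
              (λ x y → f-spec (term x ∧' term y) (A.∧-cong (proj₂ (generatedA x)) (proj₂ (generatedA y))))
              (λ x → f-spec (¬' term x) (A.¬-cong (proj₂ (generatedA x))))
              (f-spec 0' A.refl)

    G-⟦⟧ : ∀ t → Hom.⟦ G ⟧ ⟦ t ⟧τ A.≈ ⟦ t ⟧ₐ
    G-⟦⟧ t = A.trans (hom-eval G (λ _ → τ) t) (Evaluation.eval-≗ A (λ _ → Gτ≈a) t)

    G∘F : ∀ x → Hom.⟦ G ⟧ (f x) A.≈ x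
    G∘F x = A.trans (G-⟦⟧ (term x)) (proj₂ (generatedA x))

    F∘G : ∀ y → f (Hom.⟦ G ⟧ y) T.≈ y
    F∘G y = T.trans (f-spec s (A.trans (A.sym (G-⟦⟧ s)) (Hom.cong G s≈y))) s≈y
      where
      s = proj₁ (generatedT y)
      s≈y = proj₂ (generatedT y)

module _ {c₁ ℓ₁ c₂ ℓ₂} {A : KleeneAlgebra c₁ ℓ₁} {T : KleeneAlgebra c₂ ℓ₂} (A≅T : A ≅ T) where
  private
    module A = KleeneProperties A
    module T = KleeneProperties T
    F = proj₁ A≅T
    G = proj₁ (proj₂ A≅T)
    G∘F = proj₁ (proj₂ (proj₂ A≅T))

  generatedBy-≅ : ∀ {k} {g : Fin k → T.Carrier} → GeneratedBy T g → GeneratedBy A (λ i → Hom.⟦ G ⟧ (g i))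
  generatedBy-≅ {g = g} generatedT x = t , A.trans (A.sym (hom-eval G g t))
                                              (A.trans (Hom.cong G (proj₂ (generatedT (Hom.⟦ F ⟧ x)))) (G∘F x))
    where t = proj₁ (generatedT (Hom.⟦ F ⟧ x))

  oneGenerated-≅ : OneGenerated T → OneGenerated A
  oneGenerated-≅ (τ , generatedT) = Hom.⟦ G ⟧ τ , generatedBy-≅ generatedT

  exact-≅ : Exact T → Exact A
  exact-≅ ((k , g , generatedT) , n , H , H-injective) =
    (k , _ , generatedBy-≅ generatedT) , n , H ∘ʰ F ,
    λ x y HFx≈HFy → A.trans (A.sym (G∘F x))
                      (A.trans (Hom.cong G (H-injective _ _ HFx≈HFy)) (G∘F y))

F₁-generatedBy-z : GeneratedBy F₁ {1} (λ _ → var zero)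
F₁-generatedBy-z t = t , eval-generator t

K₄-generatedBy-middle : ∀ {k} → Middle k → GeneratedBy K₄ {1} (λ _ → k)
K₄-generatedBy-middle middle-a k0 = 0' , ≡.refl
K₄-generatedBy-middle middle-a kb = ¬' var zero , ≡.refl
K₄-generatedBy-middle middle-a ka = var zero , ≡.refl
K₄-generatedBy-middle middle-a k1 = 1' , ≡.refl
K₄-generatedBy-middle middle-b k0 = 0' , ≡.refl
K₄-generatedBy-middle middle-b kb = var zero , ≡.refl
K₄-generatedBy-middle middle-b ka = ¬' var zero , ≡.refl
K₄-generatedBy-middle middle-b k1 = 1' , ≡.refl

𝟚KA-generatedBy : ∀ b → GeneratedBy 𝟚KA {1} (λ _ → b)
𝟚KA-generatedBy b t0 = 0' , ≡.refl
𝟚KA-generatedBy b t1 = 1' , ≡.refl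

F₁-retract : Retract F₁ F₁
F₁-retract = idʰ F₁ , idʰ F₁ , λ _ → ~refl

K₄-retract : Retract K₄ F₁
K₄-retract = Inclusions.ι₄ F₁ (var zero ∧' (¬' var zero)) (KleeneProperties.small-x∧¬x F₁ (var zero)) ,
             Evaluation.evalʰ K₄ (λ _ → ka) ,
             λ { k0 → ≡.refl ; kb → ≡.refl ; ka → ≡.refl ; k1 → ≡.refl }

𝟚KA-retract : Retract 𝟚KA (Free (Fin 0))
𝟚KA-retract = Inclusions.ι𝟚 (Free (Fin 0)) , Evaluation.evalʰ 𝟚KA (λ ()) ,
              λ { t0 → ≡.refl ; t1 → ≡.refl }

oneGenerated×exact : ∀ {c ℓ} {T : KleeneAlgebra c ℓ} {τ} → GeneratedBy T {1} (λ _ → τ) →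
                     ∀ {n} → Retract T (Free (Fin n)) → OneGenerated T × Exact T
oneGenerated×exact {τ = τ} generated {n} retract =
  (τ , generated) , (1 , (λ _ → τ) , generated) , n , retract⇒embedding retract

oneGenerated×exact-≅ : ∀ {c₁ ℓ₁ c₂ ℓ₂} {A : KleeneAlgebra c₁ ℓ₁} {T : KleeneAlgebra c₂ ℓ₂} →
                       A ≅ T → OneGenerated T × Exact T → OneGenerated A × Exact A
oneGenerated×exact-≅ A≅T (oneGenerated , exact) = oneGenerated-≅ A≅T oneGenerated , exact-≅ A≅T exact

module _ where
  private
    module K₄ = KleeneProperties K₄

  small-middle⇒kb : ∀ {k} → Middle k → K₄.Small k → k ≡ kb
  small-middle⇒kb middle-b _ = ≡.refl

  small-¬middle⇒ka : ∀ {k} → Middle k → K₄.Small (K₄-¬ k) → k ≡ ka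
  small-¬middle⇒ka middle-a _ = ≡.refl

module Forward {c ℓ} (A : KleeneAlgebra c ℓ) {a : KleeneAlgebra.Carrier A}
               (generatedA : GeneratedBy A {1} (λ _ → a)) {n} (embedding : Embedding A (Free (Fin n))) where
  private
    module A = KleeneProperties A
    module Fₙ = KleeneProperties (Free (Fin n))
    module K₄ = KleeneProperties K₄
    open Evaluation using (evalʰ)
    open Inclusions using (ι𝟚; ι₄)

    H = proj₁ embedding
    H-injective = proj₂ embedding

    p : Term (Fin n)
    p = Hom.⟦ H ⟧ a

    ā : Fin n → K₄-El
    ā _ = ka

  reflects-at : ∀ {c′ ℓ′} (T : KleeneAlgebra c′ ℓ′) (w : Fin n → KleeneAlgebra.Carrier T) {τ} →
                KleeneAlgebra._≈_ T (eval T w p) τ → Reflects A T a τ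
  reflects-at T w = hom⇒reflects A T (evalʰ T w ∘ʰ H)

  A≅𝟚KA : ∀ b → p ~ Hom.⟦ ι𝟚 (Free (Fin n)) ⟧ b → A ≅ 𝟚KA
  A≅𝟚KA b p~b = ≅-fromGenerators A 𝟚KA generatedA (𝟚KA-generatedBy b) (ι𝟚 A) (A.sym a≈b)
                  (reflects-at 𝟚KA (λ _ → t0) (≡.trans (Evaluation.eval-cong 𝟚KA _ p~b) (eval-ι𝟚 b)))
    where
    a≈b : a A.≈ Hom.⟦ ι𝟚 A ⟧ b
    a≈b = H-injective _ _ (~trans p~b (~sym (hom-ι𝟚 H b)))
    eval-ι𝟚 : ∀ b → eval 𝟚KA (λ _ → t0) (Hom.⟦ ι𝟚 (Free (Fin n)) ⟧ b) ≡ b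
    eval-ι𝟚 t0 = ≡.refl
    eval-ι𝟚 t1 = ≡.refl

  A≅K₄ : ∀ {k} → Middle k → ∀ e (e-small : A.Small e) → Hom.⟦ ι₄ A e e-small ⟧ k A.≈ a →
         eval K₄ ā p ≡ k → A ≅ K₄
  A≅K₄ middle e e-small ιk≈a p̄≡k = ≅-fromGenerators A K₄ generatedA (K₄-generatedBy-middle middle)
                                     (ι₄ A e e-small) ιk≈a (reflects-at K₄ ā p̄≡k)

  A≅F₁ : ∀ {k} → Middle k → eval K₄ ā p ≡ k →
         ∀ w₀ → eval 𝟚KA w₀ p ≡ t0 → ∀ w₁ → eval 𝟚KA w₁ p ≡ t1 → A ≅ F₁
  A≅F₁ middle p̄≡k w₀ p₀ w₁ p₁ = ≅-fromGenerators A F₁ generatedA F₁-generatedBy-z (evalʰ A (λ _ → a)) A.refl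
    λ t u t≈u → ~trans (eval-generator t)
      (~trans (F₁-separated middle t u
                 (≡.cong₂ _,_ (reflects-at 𝟚KA w₀ p₀ t u t≈u)
                   (≡.cong₂ _,_ (reflects-at K₄ ā p̄≡k t u t≈u) (reflects-at 𝟚KA w₁ p₁ t u t≈u))))
              (~sym (eval-generator u)))

  small-unsatisfiable : ∀ q → (Satisfiable q → ⊥) → Fₙ.Small q
  small-unsatisfiable q unsat = Fₙ.small-resp-≈ (eval-var q)
    (KleeneShannon.unsatisfiable⇒small (Free (Fin n)) q (¬satisfiable⇒unsatisfiable q unsat) var)

  nonconstant : ∀ {k} → Middle k → eval K₄ ā p ≡ k → A ≅ F₁ ⊎ A ≅ K₄ ⊎ A ≅ 𝟚KA
  nonconstant {k} middle p̄≡k with satisfiable? p | satisfiable? (¬' p)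
  ... | yes (w₁ , p₁) | yes (w₀ , ¬p₀) = inj₁ (A≅F₁ middle p̄≡k w₀ p₀ w₁ p₁)
    where
    p₀ : eval 𝟚KA w₀ p ≡ t0
    p₀ = ≡.trans (≡.sym (𝟚KA-¬¬ _)) (≡.cong 𝟚KA-¬ ¬p₀)
  ... | no unsat | _ = inj₂ (inj₁ (A≅K₄ middle-b a a-small A.refl (≡.trans p̄≡k (small-middle⇒kb middle k-small))))
    where
    p-small = small-unsatisfiable p unsat
    a-small = embedding-reflects-small embedding p-small
    k-small : K₄.Small k
    k-small = ≡.subst K₄.Small p̄≡k (hom-small (evalʰ K₄ ā) p-small)
  ... | yes _ | no unsat = inj₂ (inj₁ (A≅K₄ middle-a (A.¬ a) ¬a-small (A.¬-involutive a)
                                          (≡.trans p̄≡k (small-¬middle⇒ka middle ¬k-small))))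
    where
    ¬p-small = small-unsatisfiable (¬' p) unsat
    ¬a-small = embedding-reflects-small embedding (Fₙ.small-resp-≈ (~sym (Hom.hom-¬ H a)) ¬p-small)
    ¬k-small : K₄.Small (K₄-¬ k)
    ¬k-small = ≡.subst (λ k → K₄.Small (K₄-¬ k)) p̄≡k (hom-small (evalʰ K₄ ā) ¬p-small)

  forward : A ≅ F₁ ⊎ A ≅ K₄ ⊎ A ≅ 𝟚KA
  forward with eval K₄ ā p in p̄ | Pinning.pinned-eval (Free (Fin n)) var p
  ... | k0 | Pinning.pinned-0 p≈0 = inj₂ (inj₂ (A≅𝟚KA t0 (~trans (~sym (eval-var p)) p≈0)))
  ... | k1 | Pinning.pinned-1 p≈1 = inj₂ (inj₂ (A≅𝟚KA t1 (~trans (~sym (eval-var p)) p≈1)))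
  ... | kb | Pinning.pinned-b = nonconstant middle-b p̄
  ... | ka | Pinning.pinned-a = nonconstant middle-a p̄

proposition5p5 : ∀ {c ℓ : Level} →
  ((A : KleeneAlgebra c ℓ) →
     (OneGenerated A × Exact A) ⇔ (_≅_ A F₁ ⊎ (_≅_ A K₄ ⊎ _≅_ A 𝟚KA)))
  × (Projective F₁ × (Projective K₄ × Projective 𝟚KA))
proposition5p5 =
  (λ A → mk⇔ (λ ((a , generated) , _ , n , embedding) → Forward.forward A generated embedding) backward) ,
  (Fin 1 , F₁-retract) , (Fin 1 , K₄-retract) , (Fin 0 , 𝟚KA-retract)
  where
  backward : ∀ {c ℓ} {A : KleeneAlgebra c ℓ} → A ≅ F₁ ⊎ A ≅ K₄ ⊎ A ≅ 𝟚KA → OneGenerated A × Exact A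
  backward (inj₁ A≅F₁) = oneGenerated×exact-≅ A≅F₁ (oneGenerated×exact F₁-generatedBy-z F₁-retract)
  backward (inj₂ (inj₁ A≅K₄)) = oneGenerated×exact-≅ A≅K₄ (oneGenerated×exact (K₄-generatedBy-middle middle-b) K₄-retract)
  backward (inj₂ (inj₂ A≅𝟚)) = oneGenerated×exact-≅ A≅𝟚 (oneGenerated×exact (𝟚KA-generatedBy t0) 𝟚KA-retract)
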